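{- Let $n\ge1$, $\sigma\in\mathrm{CCP}_{2n}$ and $P\in\mathcal{D}_n$. Let $\tau$ be the output of the Inverse Algorithm on input $(P,\sigma)$ and let $Q\in\mathcal{D}_n$ be the Dyck path whose tunneling is $\tau$. Then $\sigma(Q)=P$.
   Context: A Dyck path of size $n$ is a word $P_1\cdots P_{2n}$ in $\mathtt{u},\mathtt{d}$ with $n$ of each letter whose every prefix has at least as many $\mathtt{u}$'s as $\mathtt{d}$'s; $\mathcal{D}_n$ is their set. The tunneling $\tau_Q\in S_{2n}$ of $Q$ is the fixed-point-free involution pairing each up-step position with the position of its matching down-step. For $\sigma\in S_{2n}$, $\sigma_k=\sigma(k)$, $\sigma_{[k]}=\{\sigma_1,\dots,\sigma_k\}$; the $\sigma$-path $\sigma(Q)$ is the word with $\sigma(Q)_k=\mathtt{u}$ if $\tau_Q(\sigma_k)\notin\sigma_{[k]}$ and $\mathtt{d}$ otherwise. Arithmetic on $[2n]$ is modulo $2n$. A set $X\subseteq[2n]$ is a block of size $k$ if $X=\{x,\dots,x+k-1\}$ (mod $2n$) for some $x$; $x$ and $x+k-1$ are its endpoints. $\sigma$ is a CCP if $\sigma_{[k]}$ is a block of size $k$ for every $k\in[2n]$; $\mathrm{CCP}_{2n}$ is their set. Inverse Algorithm (input $P$, $\sigma\in\mathrm{CCP}_{2n}$): initially all elements of $[2n]$ are unpaired. For each $k\in[2n]$ with $P_k=\mathtt{d}$, in increasing order: (1) let $w$ be an endpoint of the block $\sigma_{[k-1]}$ cyclically adjacent to $\sigma_k$; (2) starting from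 $w$, traverse $\sigma_{[k-1]}$ (away from $\sigma_k$) to the first unpaired element $v$; (3) set $\tau(\sigma_k)=v$, $\tau(v)=\sigma_k$; (4) mark $\sigma_k, v$ paired. Output $\tau$ (which is the tunneling of a Dyck path). -}

module Defs where

open import Data.Nat using (ℕ; zero; suc; _+_; _*_; _∸_; _≤_; _<_; _<?_; _≤?_)
open import Data.Nat.DivMod using (_%_; m%n<n)
open import Data.Fin using (Fin; toℕ; fromℕ<; _≟_)
open import Data.Fin.Properties using (any?)
open import Data.Fin.Permutation using (Permutation′; _⟨$⟩ʳ_)
open import Data.Vec using (Vec; toList; lookup; tabulate)
open import Data.List using (List; []; _∷_; length; filter; take; drop; map; upTo; allFin; foldl)
open import Data.Maybe using (Maybe; just; nothing)
open import Data.Bool using (Bool; true; false; if_then_else_)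
open import Data.Product using (Σ; ∃; _×_; _,_)
open import Data.Sum using (_⊎_)
open import Relation.Binary.PropositionalEquality using (_≡_)
open import Relation.Nullary using (Dec; yes; no; ¬_)
open import Relation.Nullary.Decidable using (⌊_⌋; _×-dec_)
open import Function.Bundles using (_⇔_)

-- Steps and Dyck paths.  Positions are 0-indexed: [2n] ≅ Fin (2 * n).

data Step : Set where
  u d : Step

isU : Step → Bool
isU u = true
isU d = false

isD : Step → Bool
isD u = false
isD d = true

#u : List Step → ℕ
#u [] = 0
#u (s ∷ w) = (if isU s then 1 else 0) + #u w

#d : List Step → ℕ
#d [] = 0
#d (s ∷ w) = (if isD s then 1 else 0) + #d w

IsDyck : (n : ℕ) → Vec Step (2 * n) → Set
IsDyck n P =
  (#u (toList P) ≡ n) × (#d (toList P) ≡ n) ×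
  (∀ k → #d (take k (toList P)) ≤ #u (take k (toList P)))

-- the factor Q_i Q_{i+1} ... Q_j (inclusive), for i ≤ j
segment : ∀ {m} → Vec Step m → ℕ → ℕ → List Step
segment Q i j = take (suc (j ∸ i)) (drop i (toList Q))

Matched : ∀ {m} → Vec Step m → Fin m → Fin m → Set
Matched Q i j =
  (toℕ i < toℕ j) × (lookup Q i ≡ u) × (lookup Q j ≡ d) ×
  (#u (segment Q (toℕ i) (toℕ j)) ≡ #d (segment Q (toℕ i) (toℕ j))) ×
  (∀ l → toℕ i ≤ l → l < toℕ j →
     #d (segment Q (toℕ i) l) < #u (segment Q (toℕ i) l))

IsTunneling : ∀ {m} → Vec Step m → (Fin m → Fin m) → Set
IsTunneling Q τ = ∀ i j → (τ i ≡ j) ⇔ (Matched Q i j ⊎ Matched Q j i)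

addMod : ∀ {m} → Fin m → ℕ → Fin m
addMod {suc k} x j = fromℕ< (m%n<n (toℕ x + j) (suc k))

-- x - j (mod m), for j ≤ m
subMod : ∀ {m} → Fin m → ℕ → Fin m
subMod {m} x j = addMod x (m ∸ j)

-- σ_[k] = {σ_1, …, σ_k}; in 0-indexed form the images of the first k
-- positions.

InPrefix : ∀ {m} → Permutation′ m → ℕ → Fin m → Set
InPrefix σ k y = ∃ λ i → (toℕ i < k) × (σ ⟨$⟩ʳ i ≡ y)

inPrefix? : ∀ {m} (σ : Permutation′ m) (k : ℕ) (y : Fin m) → Dec (InPrefix σ k y)
inPrefix? σ k y = any? (λ i → (toℕ i <? k) ×-dec (σ ⟨$⟩ʳ i ≟ y))

IsBlock : ∀ {m} → (Fin m → Set) → ℕ → Set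
IsBlock {m} X k = ∃ λ (x : Fin m) → ∀ y → X y ⇔ (∃ λ j → (j < k) × (y ≡ addMod x j))

IsCCP : ∀ {m} → Permutation′ m → Set
IsCCP {m} σ = ∀ k → 1 ≤ k → k ≤ m → IsBlock (InPrefix σ k) k

-- σ-path:  σ(Q)_k = u if τ_Q(σ_k) ∉ σ_[k], and d otherwise.
-- (0-indexed: σ_[k] for 1-indexed k is InPrefix σ (toℕ k + 1).)

σPath : ∀ {m} → Permutation′ m → (Fin m → Fin m) → Vec Step m
σPath σ τ = tabulate λ k →
  if ⌊ inPrefix? σ (suc (toℕ k)) (τ (σ ⟨$⟩ʳ k)) ⌋ then d else u

-- The Inverse Algorithm.
-- A state records, for each element, its partner (nothing = unpaired).

State : ℕ → Set
State m = Fin m → Maybe (Fin m)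

isUnpaired : ∀ {m} → State m → Fin m → Bool
isUnpaired st x with st x
... | nothing = true
... | just _  = false

firstWith : ∀ {m} → (Fin m → Bool) → List (Fin m) → Maybe (Fin m)
firstWith p [] = nothing
firstWith p (x ∷ xs) = if p x then just x else firstWith p xs

pair : ∀ {m} → State m → Fin m → Fin m → State m
pair st a b z with z ≟ a | z ≟ b
... | yes _ | _     = just b
... | no _  | yes _ = just a
... | no _  | no _  = st z

-- Processing position k (0-indexed; σ_[k-1] of the paper is InPrefix σ (toℕ k)).  The block σ_[k-1] has toℕ k elements.  If s-1 lies in
-- it, the adjacent endpoint is w = s-1 and traversing away from s visits
-- s-1, s-2, …, s-k; otherwise w = s+1 and the traversal visits s+1, …, s+k.
-- v is the first unpaired element met; then s and v are paired.
-- candidates of the traversal, in order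
traversal : ∀ {m} → Permutation′ m → Fin m → List (Fin m)
traversal σ k = map cand (map suc (upTo (toℕ k)))
  where
    s = σ ⟨$⟩ʳ k
    cand : ℕ → _
    cand j = if ⌊ inPrefix? σ (toℕ k) (subMod s 1) ⌋ then subMod s j else addMod s j

pairWith : ∀ {m} → State m → Fin m → Maybe (Fin m) → State m
pairWith st s nothing  = st
pairWith st s (just v) = pair st s v

algStep : ∀ {m} → Vec Step m → Permutation′ m → State m → Fin m → State m
algStep P σ st k with lookup P k
... | u = st
... | d = pairWith st (σ ⟨$⟩ʳ k) (firstWith (isUnpaired st) (traversal σ k))

inverseAlgorithm : ∀ {m} → Vec Step m → Permutation′ m → State m
inverseAlgorithm {m} P σ = foldl (algStep P σ) (λ _ → nothing) (allFin m)

-- By induction over the rounds, the partial matching built by the Inverse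
-- Algorithm lives on the block σ_[k], pairs each down-step position with an
-- earlier element, leaves exactly #u - #d of P_1 … P_k unpaired, and is nested
-- when the block is read from its left endpoint: whatever lies under an arc is
-- paired under it.  The traversal pairs σ_k with the nearest unpaired element
-- v, and everything between σ_k and v is already paired among itself, so the
-- new arc keeps the matching nested.  As P is balanced the final matching τ is
-- perfect; nestedness survives rotation, so τ is a noncrossing perfect
-- matching of [2n] in the usual order, which is the tunneling of the Dyck path
-- Q with Q_i = u exactly when i < τ(i).  The side on which each partner was
-- found is precisely what σ(Q) reads off, whence σ(Q) = P.
module Submission where

open import Defs
open import Data.Bool using (Bool; true; false; if_then_else_)
open import Data.Empty using (⊥-elim)
open import Data.Fin using (Fin; toℕ; fromℕ<; _≟_) renaming (zero to fzero; suc to fsuc)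
open import Data.Fin.Permutation using (Permutation′; _⟨$⟩ʳ_; _⟨$⟩ˡ_; inverseˡ; inverseʳ)
open import Data.Fin.Properties using (toℕ-fromℕ<; toℕ-injective; toℕ<n; fromℕ<-toℕ)
open import Data.List using (List; []; _∷_; length; take; drop; map; _++_; applyUpTo; foldl)
open import Data.List.Properties using (map-++; map-applyUpTo; take-all)
open import Data.Maybe using (Maybe; just; nothing)
open import Data.Maybe.Properties using (just-injective)
open import Data.Nat using (ℕ; zero; suc; _+_; _*_; _∸_; _≤_; _<_; _<?_; _≤?_; z≤n; s≤s; z<s)
open import Data.Nat.DivMod using (_%_; %-distribˡ-+; m%n%n≡m%n; [m+n]%n≡m%n; m<n⇒m%n≡m; n%n≡0)
open import Data.Nat.Induction using (<-rec)
open import Data.Nat.Properties hiding (_≟_)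
open import Data.Nat.Tactic.RingSolver using (solve-∀)
open import Data.Product using (∃; _×_; _,_; proj₁; proj₂)
open import Data.Sum using (_⊎_; inj₁; inj₂)
open import Data.Vec using (Vec; toList; lookup; tabulate) renaming (_∷_ to _∷ᵥ_)
open import Data.Vec.Properties using (lookup∘tabulate; length-toList; tabulate-cong; tabulate∘lookup)
open import Function.Bundles using (_⇔_; mk⇔; Equivalence)
open import Relation.Binary using (tri<; tri≈; tri>)
open import Relation.Binary.PropositionalEquality
open import Relation.Nullary using (¬_; yes; no; Dec)
open import Relation.Nullary.Decidable using (⌊_⌋; isYes≗does; dec-true; dec-false)

-- Cyclic arithmetic on positions

module _ {M : ℕ} where
  private
    m = suc M

  toℕ-addMod : (x : Fin m) (j : ℕ) → toℕ (addMod x j) ≡ (toℕ x + j) % m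
  toℕ-addMod x j = toℕ-fromℕ< _

  addMod-cong : (x : Fin m) {i j : ℕ} → i % m ≡ j % m → addMod x i ≡ addMod x j
  addMod-cong x {i} {j} i≡j = toℕ-injective (begin
      toℕ (addMod x i)              ≡⟨ toℕ-addMod x i ⟩
      (toℕ x + i) % m               ≡⟨ %-distribˡ-+ (toℕ x) i m ⟩
      (toℕ x % m + i % m) % m       ≡⟨ cong (λ t → (toℕ x % m + t) % m) i≡j ⟩
      (toℕ x % m + j % m) % m       ≡⟨ sym (%-distribˡ-+ (toℕ x) j m) ⟩
      (toℕ x + j) % m               ≡⟨ sym (toℕ-addMod x j) ⟩
      toℕ (addMod x j)              ∎)
    where open ≡-Reasoning

  addMod-addMod : (x : Fin m) (i j : ℕ) → addMod (addMod x i) j ≡ addMod x (i + j)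
  addMod-addMod x i j = toℕ-injective (begin
      toℕ (addMod (addMod x i) j)   ≡⟨ toℕ-addMod (addMod x i) j ⟩
      (toℕ (addMod x i) + j) % m    ≡⟨ cong (λ t → (t + j) % m) (toℕ-addMod x i) ⟩
      ((toℕ x + i) % m + j) % m     ≡⟨ %-distribˡ-+ ((toℕ x + i) % m) j m ⟩
      ((toℕ x + i) % m % m + j % m) % m ≡⟨ cong (λ t → (t + j % m) % m) (m%n%n≡m%n (toℕ x + i) m) ⟩
      ((toℕ x + i) % m + j % m) % m ≡⟨ sym (%-distribˡ-+ (toℕ x + i) j m) ⟩
      (toℕ x + i + j) % m           ≡⟨ cong (_% m) (+-assoc (toℕ x) i j) ⟩
      (toℕ x + (i + j)) % m         ≡⟨ sym (toℕ-addMod x (i + j)) ⟩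
      toℕ (addMod x (i + j))        ∎)
    where open ≡-Reasoning

  addMod-identityʳ : (x : Fin m) → addMod x 0 ≡ x
  addMod-identityʳ x = toℕ-injective (begin
      toℕ (addMod x 0)  ≡⟨ toℕ-addMod x 0 ⟩
      (toℕ x + 0) % m   ≡⟨ cong (_% m) (+-identityʳ (toℕ x)) ⟩
      toℕ x % m         ≡⟨ m<n⇒m%n≡m (toℕ<n x) ⟩
      toℕ x             ∎)
    where open ≡-Reasoning

  addMod-period : (x : Fin m) (j : ℕ) → addMod x (j + m) ≡ addMod x j
  addMod-period x j = addMod-cong x ([m+n]%n≡m%n j m)

  addMod-comm : (x y : Fin m) → addMod x (toℕ y) ≡ addMod y (toℕ x)
  addMod-comm x y = toℕ-injective (begin
      toℕ (addMod x (toℕ y))  ≡⟨ toℕ-addMod x (toℕ y) ⟩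
      (toℕ x + toℕ y) % m     ≡⟨ cong (_% m) (+-comm (toℕ x) (toℕ y)) ⟩
      (toℕ y + toℕ x) % m     ≡⟨ sym (toℕ-addMod y (toℕ x)) ⟩
      toℕ (addMod y (toℕ x))  ∎)
    where open ≡-Reasoning

  subMod-addMod : (x : Fin m) {i : ℕ} (j : ℕ) → i ≤ m → subMod (addMod x (i + j)) i ≡ addMod x j
  subMod-addMod x {i} j i≤m = begin
      addMod (addMod x (i + j)) (m ∸ i) ≡⟨ addMod-addMod x (i + j) (m ∸ i) ⟩
      addMod x (i + j + (m ∸ i))        ≡⟨ cong (λ t → addMod x (t + (m ∸ i))) (+-comm i j) ⟩
      addMod x (j + i + (m ∸ i))        ≡⟨ cong (addMod x) (+-assoc j i (m ∸ i)) ⟩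
      addMod x (j + (i + (m ∸ i)))      ≡⟨ cong (λ t → addMod x (j + t)) (m+[n∸m]≡n i≤m) ⟩
      addMod x (j + m)                  ≡⟨ addMod-period x j ⟩
      addMod x j                        ∎
    where open ≡-Reasoning

  addMod-subMod : (x : Fin m) {i : ℕ} → i ≤ m → addMod (subMod x i) i ≡ x
  addMod-subMod x {i} i≤m = begin
      addMod (addMod x (m ∸ i)) i ≡⟨ addMod-addMod x (m ∸ i) i ⟩
      addMod x (m ∸ i + i)        ≡⟨ cong (addMod x) (m∸n+n≡m i≤m) ⟩
      addMod x (0 + m)            ≡⟨ addMod-period x 0 ⟩
      addMod x 0                  ≡⟨ addMod-identityʳ x ⟩
      x                           ∎
    where open ≡-Reasoning

  subMod-toℕ-self : (x : Fin m) → subMod x (toℕ x) ≡ fzero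
  subMod-toℕ-self x = toℕ-injective (begin
      toℕ (addMod x (m ∸ toℕ x)) ≡⟨ toℕ-addMod x (m ∸ toℕ x) ⟩
      (toℕ x + (m ∸ toℕ x)) % m  ≡⟨ cong (_% m) (m+[n∸m]≡n (<⇒≤ (toℕ<n x))) ⟩
      m % m                      ≡⟨ n%n≡0 m ⟩
      0                          ∎)
    where open ≡-Reasoning

  toℕ-addMod-fzero : {j : ℕ} → j < m → toℕ (addMod fzero j) ≡ j
  toℕ-addMod-fzero {j} j<m = trans (toℕ-addMod fzero j) (m<n⇒m%n≡m j<m)

  addMod-fzero-toℕ : (x : Fin m) → addMod fzero (toℕ x) ≡ x
  addMod-fzero-toℕ x = toℕ-injective (toℕ-addMod-fzero (toℕ<n x))

  addMod-injective : (x : Fin m) {i j : ℕ} → i < m → j < m → addMod x i ≡ addMod x j → i ≡ j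
  addMod-injective x {i} {j} i<m j<m eq = begin
      i                                    ≡⟨ sym (toℕ-addMod-fzero i<m) ⟩
      toℕ (addMod fzero i)                 ≡⟨ cong toℕ (rebase i) ⟩
      toℕ (subMod (addMod x i) (toℕ x))    ≡⟨ cong (λ y → toℕ (subMod y (toℕ x))) eq ⟩
      toℕ (subMod (addMod x j) (toℕ x))    ≡⟨ cong toℕ (sym (rebase j)) ⟩
      toℕ (addMod fzero j)                 ≡⟨ toℕ-addMod-fzero j<m ⟩
      j                                    ∎
    where
      open ≡-Reasoning
      rebase : ∀ k → addMod fzero k ≡ subMod (addMod x k) (toℕ x)
      rebase k = begin
        addMod fzero k                                   ≡⟨ sym (subMod-addMod fzero k (<⇒≤ (toℕ<n x))) ⟩
        subMod (addMod fzero (toℕ x + k)) (toℕ x)        ≡⟨ cong (λ y → subMod y (toℕ x)) (sym (addMod-addMod fzero (toℕ x) k)) ⟩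
        subMod (addMod (addMod fzero (toℕ x)) k) (toℕ x) ≡⟨ cong (λ y → subMod (addMod y k) (toℕ x)) (addMod-fzero-toℕ x) ⟩
        subMod (addMod x k) (toℕ x)                      ∎

  addMod-surjective : (x y : Fin m) → ∃ λ j → j < m × y ≡ addMod x j
  addMod-surjective x y = toℕ (subMod y (toℕ x)) , toℕ<n _ ,
    trans (sym (addMod-subMod y (<⇒≤ (toℕ<n x)))) (addMod-comm (subMod y (toℕ x)) x)

-- Noncrossing perfect matchings as tunnelings

#u-++ : ∀ xs ys → #u (xs ++ ys) ≡ #u xs + #u ys
#u-++ []       ys = refl
#u-++ (u ∷ xs) ys = cong suc (#u-++ xs ys)
#u-++ (d ∷ xs) ys = #u-++ xs ys

#d-++ : ∀ xs ys → #d (xs ++ ys) ≡ #d xs + #d ys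
#d-++ []       ys = refl
#d-++ (u ∷ xs) ys = #d-++ xs ys
#d-++ (d ∷ xs) ys = cong suc (#d-++ xs ys)

#u+#d≡length : ∀ xs → #u xs + #d xs ≡ length xs
#u+#d≡length []       = refl
#u+#d≡length (u ∷ xs) = cong suc (#u+#d≡length xs)
#u+#d≡length (d ∷ xs) = trans (+-suc (#u xs) (#d xs)) (cong suc (#u+#d≡length xs))

#u-snoc-u : ∀ xs → #u (xs ++ u ∷ []) ≡ suc (#u xs)
#u-snoc-u xs = trans (#u-++ xs (u ∷ [])) (+-comm (#u xs) 1)

#d-snoc-u : ∀ xs → #d (xs ++ u ∷ []) ≡ #d xs
#d-snoc-u xs = trans (#d-++ xs (u ∷ [])) (+-identityʳ (#d xs))

#u-snoc-d : ∀ xs → #u (xs ++ d ∷ []) ≡ #u xs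
#u-snoc-d xs = trans (#u-++ xs (d ∷ [])) (+-identityʳ (#u xs))

#d-snoc-d : ∀ xs → #d (xs ++ d ∷ []) ≡ suc (#d xs)
#d-snoc-d xs = trans (#d-++ xs (d ∷ [])) (+-comm (#d xs) 1)

balanced⇒IsDyck : ∀ n (P : Vec Step (2 * n)) → #u (toList P) ≡ #d (toList P) →
                  (∀ k → #d (take k (toList P)) ≤ #u (take k (toList P))) → IsDyck n P
balanced⇒IsDyck n P u≡d prefixes = #u≡n , trans (sym u≡d) #u≡n , prefixes
  where
    open ≡-Reasoning
    #u≡n : #u (toList P) ≡ n
    #u≡n = *-cancelˡ-≡ _ n 2 (begin
      2 * #u (toList P)                 ≡⟨ cong (#u (toList P) +_) (+-identityʳ _) ⟩
      #u (toList P) + #u (toList P)     ≡⟨ cong (#u (toList P) +_) u≡d ⟩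
      #u (toList P) + #d (toList P)     ≡⟨ #u+#d≡length (toList P) ⟩
      length (toList P)                 ≡⟨ length-toList P ⟩
      2 * n                             ∎)

toℕ-preimage : ∀ {m p} → p < m → ∃ λ (i : Fin m) → toℕ i ≡ p
toℕ-preimage p<m = fromℕ< p<m , toℕ-fromℕ< p<m

interval : ℕ → ℕ → List ℕ
interval a zero    = []
interval a (suc k) = a ∷ interval (suc a) k

interval-++ : ∀ a x y → interval a (x + y) ≡ interval a x ++ interval (a + x) y
interval-++ a zero    y = cong (λ t → interval t y) (sym (+-identityʳ a))
interval-++ a (suc x) y = cong (a ∷_) (trans (interval-++ (suc a) x y) (cong (λ t → interval (suc a) x ++ interval t y) (sym (+-suc a x))))

-- The default d at out-of-range positions is never observed.
nth : List Step → ℕ → Step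
nth []       p       = d
nth (x ∷ xs) zero    = x
nth (x ∷ xs) (suc p) = nth xs p

map-nth-∷ : ∀ x xs a k → map (nth (x ∷ xs)) (interval (suc a) k) ≡ map (nth xs) (interval a k)
map-nth-∷ x xs a zero    = refl
map-nth-∷ x xs a (suc k) = cong (nth xs a ∷_) (map-nth-∷ x xs (suc a) k)

take-drop≡map-nth : ∀ i k (xs : List Step) → i + k ≤ length xs → take k (drop i xs) ≡ map (nth xs) (interval i k)
take-drop≡map-nth zero    zero    xs       le        = refl
take-drop≡map-nth zero    (suc k) (x ∷ xs) (s≤s le) =
  cong (x ∷_) (trans (take-drop≡map-nth zero k xs le) (sym (map-nth-∷ x xs 0 k)))
take-drop≡map-nth (suc i) k       (x ∷ xs) (s≤s le) =
  trans (take-drop≡map-nth i k xs le) (sym (map-nth-∷ x xs i k))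

nth-toList : ∀ {m} (V : Vec Step m) (i : Fin m) → nth (toList V) (toℕ i) ≡ lookup V i
nth-toList (x ∷ᵥ V) fzero    = refl
nth-toList (x ∷ᵥ V) (fsuc i) = nth-toList V i

take-suc-toList : ∀ {n} (V : Vec Step n) (i : Fin n) → take (suc (toℕ i)) (toList V) ≡ take (toℕ i) (toList V) ++ (lookup V i ∷ [])
take-suc-toList (x ∷ᵥ V) fzero    = refl
take-suc-toList (x ∷ᵥ V) (fsuc i) = cong (x ∷_) (take-suc-toList V i)

Matched-functional : ∀ {m} (Q : Vec Step m) {i j j′} → Matched Q i j → Matched Q i j′ → j ≡ j′
Matched-functional Q {i} {j} {j′} (i<j , _ , _ , bal , strict) (i<j′ , _ , _ , bal′ , strict′) with <-cmp (toℕ j) (toℕ j′)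
... | tri< j<j′ _ _ = ⊥-elim (<-irrefl (sym bal) (strict′ (toℕ j) (<⇒≤ i<j) j<j′))
... | tri≈ _ j≡j′ _ = toℕ-injective j≡j′
... | tri> _ _ j′<j = ⊥-elim (<-irrefl (sym bal′) (strict (toℕ j′) (<⇒≤ i<j′) j′<j))

module NoncrossingMatching {m : ℕ} (τ : Fin m → Fin m)
  (τ-involutive : ∀ i → τ (τ i) ≡ i)
  (τ-fixedPointFree : ∀ i → τ i ≢ i)
  (τ-noncrossing : ∀ i j → toℕ i < toℕ j → toℕ j < toℕ (τ i) → toℕ i < toℕ (τ j) × toℕ (τ j) < toℕ (τ i))
  where

  stepOf : Fin m → Step
  stepOf i with toℕ i <? toℕ (τ i)
  ... | yes _ = u
  ... | no _  = d

  path : Vec Step m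
  path = tabulate stepOf

  τ-injective : ∀ {i j} → τ i ≡ τ j → i ≡ j
  τ-injective {i} {j} eq = trans (sym (τ-involutive i)) (trans (cong τ eq) (τ-involutive j))

  toℕ-τ≢ : ∀ i → toℕ (τ i) ≢ toℕ i
  toℕ-τ≢ i eq = τ-fixedPointFree i (toℕ-injective eq)

  toℕ-ττ : ∀ i → toℕ (τ (τ i)) ≡ toℕ i
  toℕ-ττ i = cong toℕ (τ-involutive i)

  stepOf-opener : ∀ i → toℕ i < toℕ (τ i) → stepOf i ≡ u
  stepOf-opener i lt with toℕ i <? toℕ (τ i)
  ... | yes _  = refl
  ... | no ¬lt = ⊥-elim (¬lt lt)

  stepOf-closer : ∀ i → toℕ (τ i) < toℕ i → stepOf i ≡ d
  stepOf-closer i lt with toℕ i <? toℕ (τ i)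
  ... | yes lt′ = ⊥-elim (<-asym lt lt′)
  ... | no _    = refl

  stepOf-partner : ∀ i → toℕ i < toℕ (τ i) → stepOf (τ i) ≡ d
  stepOf-partner i lt = stepOf-closer (τ i) (subst (_< toℕ (τ i)) (sym (toℕ-ττ i)) lt)

  stepOf≡u⇒opener : ∀ i → stepOf i ≡ u → toℕ i < toℕ (τ i)
  stepOf≡u⇒opener i eq with toℕ i <? toℕ (τ i)
  ... | yes lt = lt
  stepOf≡u⇒opener i () | no _

  stepOf≡d⇒closer : ∀ i → stepOf i ≡ d → toℕ (τ i) < toℕ i
  stepOf≡d⇒closer i eq with toℕ i <? toℕ (τ i)
  stepOf≡d⇒closer i () | yes _
  ... | no ¬lt = ≤∧≢⇒< (≮⇒≥ ¬lt) (toℕ-τ≢ i)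

  partner-beyond-arc : ∀ i j → toℕ i < toℕ (τ i) → toℕ (τ i) < toℕ j → toℕ i ≤ toℕ (τ j) → toℕ (τ i) < toℕ (τ j)
  partner-beyond-arc i j i<τi τi<j i≤τj with <-cmp (toℕ (τ i)) (toℕ (τ j))
  ... | tri< lt _ _ = lt
  ... | tri≈ _ eq _ = ⊥-elim (<-irrefl (cong toℕ (τ-injective (toℕ-injective eq))) (<-trans i<τi τi<j))
  ... | tri> _ _ gt with m≤n⇒m<n∨m≡n i≤τj
  ...   | inj₂ eq = ⊥-elim (<-irrefl (trans (cong toℕ (cong τ (toℕ-injective eq))) (toℕ-ττ j)) τi<j)
  ...   | inj₁ lt = ⊥-elim (<-asym (subst (_< toℕ (τ i)) (toℕ-ττ j) (proj₂ (τ-noncrossing i (τ j) lt gt))) τi<j)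

  stepAt : ℕ → Step
  stepAt = nth (toList path)

  stepAt-toℕ : ∀ i → stepAt (toℕ i) ≡ stepOf i
  stepAt-toℕ i = trans (nth-toList path i) (lookup∘tabulate stepOf i)

  #U #D : ℕ → ℕ → ℕ
  #U a k = #u (map stepAt (interval a k))
  #D a k = #d (map stepAt (interval a k))

  ClosedInterval : ℕ → ℕ → Set
  ClosedInterval a k = ∀ j → a ≤ toℕ j → toℕ j < a + k → a ≤ toℕ (τ j) × toℕ (τ j) < a + k

  NoDownLeaves : ℕ → ℕ → Set
  NoDownLeaves a k = ∀ j → a ≤ toℕ j → toℕ j < a + k → stepOf j ≡ d → a ≤ toℕ (τ j)

  arc-interior-closed : ∀ i x → suc (toℕ i) + x ≡ toℕ (τ i) → ClosedInterval (suc (toℕ i)) x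
  arc-interior-closed i x end j i<j j<end = proj₁ nested , subst (toℕ (τ j) <_) (sym end) (proj₂ nested)
    where nested = τ-noncrossing i j i<j (subst (toℕ j <_) end j<end)

  -- [a, a + k] = {a} ∪ (a, c) ∪ {c} ∪ (c, a + k] for the arc from a to c.
  record ArcSplit (a k c : ℕ) : Set where
    field
      inner outer    : ℕ
      inner-end      : suc a + inner ≡ c
      outer-end      : suc c + outer ≡ a + suc k
      inner<         : inner < suc k
      outer<         : outer < suc k
      #D-split       : #D a (suc k) ≡ suc (#D (suc a) inner + #D (suc c) outer)
      #U-split       : #U a (suc k) ≡ suc (#U (suc a) inner + #U (suc c) outer)

  arc-split : ∀ {a k c} → a < c → c < a + suc k → stepAt a ≡ u → stepAt c ≡ d → ArcSplit a k c
  arc-split {a} {k} {c} a<c c<end sa sc = record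
    { inner = x ; outer = y ; inner-end = x-end ; outer-end = y-end
    ; inner< = s≤s (≤-trans (m≤m+n x (suc y)) (≤-reflexive (sym k≡)))
    ; outer< = s≤s (≤-trans (≤-trans (n≤1+n y) (m≤n+m (suc y) x)) (≤-reflexive (sym k≡)))
    ; #D-split = trans (cong (λ l → #d (map stepAt l)) shape) (#D-shape)
    ; #U-split = trans (cong (λ l → #u (map stepAt l)) shape) (#U-shape) }
    where
      x = proj₁ (m≤n⇒∃[o]m+o≡n a<c)
      x-end = proj₂ (m≤n⇒∃[o]m+o≡n a<c)
      y = proj₁ (m≤n⇒∃[o]m+o≡n c<end)
      y-end = proj₂ (m≤n⇒∃[o]m+o≡n c<end)
      rearrange : ∀ a x y → a + suc (x + suc y) ≡ suc (suc a + x) + y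
      rearrange = solve-∀
      k≡ : k ≡ x + suc y
      k≡ = suc-injective (+-cancelˡ-≡ a (suc k) _ (trans (sym y-end)
             (trans (cong (λ t → suc t + y) (sym x-end)) (sym (rearrange a x y)))))
      shape : interval a (suc k) ≡ a ∷ (interval (suc a) x ++ (c ∷ interval (suc c) y))
      shape = begin
        interval a (suc k)                                     ≡⟨ cong (λ t → interval a (suc t)) k≡ ⟩
        a ∷ interval (suc a) (x + suc y)                       ≡⟨ cong (a ∷_) (interval-++ (suc a) x (suc y)) ⟩
        a ∷ (interval (suc a) x ++ interval (suc a + x) (suc y)) ≡⟨ cong (λ t → a ∷ (interval (suc a) x ++ interval t (suc y))) x-end ⟩
        a ∷ (interval (suc a) x ++ (c ∷ interval (suc c) y))   ∎
        where open ≡-Reasoning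
      inside = map stepAt (interval (suc a) x)
      beyond = map stepAt (interval (suc c) y)
      #D-shape : #d (map stepAt (a ∷ (interval (suc a) x ++ (c ∷ interval (suc c) y)))) ≡ suc (#d inside + #d beyond)
      #D-shape rewrite map-++ stepAt (interval (suc a) x) (c ∷ interval (suc c) y) | sa | sc =
        trans (#d-++ inside (d ∷ beyond)) (+-suc (#d inside) (#d beyond))
      #U-shape : #u (map stepAt (a ∷ (interval (suc a) x ++ (c ∷ interval (suc c) y)))) ≡ suc (#u inside + #u beyond)
      #U-shape rewrite map-++ stepAt (interval (suc a) x) (c ∷ interval (suc c) y) | sa | sc =
        cong suc (#u-++ inside (d ∷ beyond))

  opening-arc-split : ∀ i k → toℕ i < toℕ (τ i) → toℕ (τ i) < toℕ i + suc k → ArcSplit (toℕ i) k (toℕ (τ i))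
  opening-arc-split i k i<τi τi<end = arc-split i<τi τi<end
    (trans (stepAt-toℕ i) (stepOf-opener i i<τi)) (trans (stepAt-toℕ (τ i)) (stepOf-partner i i<τi))

  closed-balanced : ∀ k a → a + k ≤ m → ClosedInterval a k → #D a k ≡ #U a k
  closed-balanced = <-rec _ balanced
    where
      balanced : ∀ k → (∀ {k'} → k' < k → ∀ a → a + k' ≤ m → ClosedInterval a k' → #D a k' ≡ #U a k') →
                 ∀ a → a + k ≤ m → ClosedInterval a k → #D a k ≡ #U a k
      balanced zero    _   a _ _ = refl
      balanced (suc k) rec a end≤m closed with toℕ-preimage (<-≤-trans (m<m+n a z<s) end≤m)
      ... | i , refl = begin
          #D a (suc k)                                ≡⟨ #D-split ⟩
          suc (#D (suc a) inner + #D (suc c) outer)   ≡⟨ cong suc (cong₂ _+_ inner-balanced outer-balanced) ⟩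
          suc (#U (suc a) inner + #U (suc c) outer)   ≡⟨ sym #U-split ⟩
          #U a (suc k)                                ∎
        where
          open ≡-Reasoning
          c = toℕ (τ i)
          τi-inside = closed i ≤-refl (m<m+n a z<s)
          i<τi : a < c
          i<τi = ≤∧≢⇒< (proj₁ τi-inside) (λ eq → toℕ-τ≢ i (sym eq))
          open ArcSplit (opening-arc-split i k i<τi (proj₂ τi-inside))
          inner-balanced : #D (suc a) inner ≡ #U (suc a) inner
          inner-balanced = rec inner< (suc a) (subst (_≤ m) (sym inner-end) (<⇒≤ (toℕ<n (τ i))))
            (arc-interior-closed i inner inner-end)
          outer-closed : ClosedInterval (suc c) outer
          outer-closed j c<j j<end = partner-beyond-arc i j i<τi c<j (proj₁ τj-inside) ,
                                        subst (toℕ (τ j) <_) (sym outer-end) (proj₂ τj-inside)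
            where τj-inside = closed j (<⇒≤ (<-trans i<τi c<j)) (subst (toℕ j <_) outer-end j<end)
          outer-balanced : #D (suc c) outer ≡ #U (suc c) outer
          outer-balanced = rec outer< (suc c) (subst (_≤ m) (sym outer-end) end≤m) outer-closed

  noDownLeaves-dominated : ∀ k a → a + k ≤ m → NoDownLeaves a k → #D a k ≤ #U a k
  noDownLeaves-dominated = <-rec _ dominated
    where
      dominated : ∀ k → (∀ {k'} → k' < k → ∀ a → a + k' ≤ m → NoDownLeaves a k' → #D a k' ≤ #U a k') →
                  ∀ a → a + k ≤ m → NoDownLeaves a k → #D a k ≤ #U a k
      dominated zero    _   a _ _ = z≤n
      dominated (suc k) rec a end≤m noLeaves with toℕ-preimage (<-≤-trans (m<m+n a z<s) end≤m)
      ... | i , refl with stepOf i in step-i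
      ... | d = ⊥-elim (<⇒≱ (stepOf≡d⇒closer i step-i) (noLeaves i ≤-refl (m<m+n a z<s) step-i))
      ... | u with toℕ (τ i) <? a + suc k
      ...   | yes τi<end = subst₂ _≤_ (sym #D-split) (sym #U-split)
                (s≤s (+-mono-≤ (≤-reflexive inner-balanced) outer-dominated))
        where
          c = toℕ (τ i)
          i<τi = stepOf≡u⇒opener i step-i
          open ArcSplit (opening-arc-split i k i<τi τi<end)
          inner-balanced : #D (suc a) inner ≡ #U (suc a) inner
          inner-balanced = closed-balanced inner (suc a) (subst (_≤ m) (sym inner-end) (<⇒≤ (toℕ<n (τ i))))
            (arc-interior-closed i inner inner-end)
          outer-dominated : #D (suc c) outer ≤ #U (suc c) outer
          outer-dominated = rec outer< (suc c) (subst (_≤ m) (sym outer-end) end≤m)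
            λ j c<j j<end down → partner-beyond-arc i j i<τi c<j
                                   (noLeaves j (<⇒≤ (<-trans i<τi c<j)) (subst (toℕ j <_) outer-end j<end) down)
      ...   | no τi≮end = subst₂ _≤_ (sym #D-drop) (sym #U-drop) (m≤n⇒m≤1+n rest-dominated)
        where
          stepAt-a : stepAt a ≡ u
          stepAt-a = trans (stepAt-toℕ i) step-i
          #D-drop : #D a (suc k) ≡ #D (suc a) k
          #D-drop rewrite stepAt-a = refl
          #U-drop : #U a (suc k) ≡ suc (#U (suc a) k)
          #U-drop rewrite stepAt-a = refl
          rest-dominated : #D (suc a) k ≤ #U (suc a) k
          rest-dominated = rec ≤-refl (suc a) (subst (_≤ m) (+-suc a k) end≤m)
            λ j a<j j<end _ → proj₁ (τ-noncrossing i j a<j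
                                      (<-≤-trans (subst (toℕ j <_) (sym (+-suc a k)) j<end) (≮⇒≥ τi≮end)))

  segment-path : ∀ a l → a ≤ l → l < m → segment path a l ≡ map stepAt (interval a (suc (l ∸ a)))
  segment-path a l a≤l l<m = take-drop≡map-nth a (suc (l ∸ a)) (toList path)
    (subst₂ _≤_ (sym (trans (+-suc a (l ∸ a)) (cong suc (m+[n∸m]≡n a≤l)))) (sym (length-toList path)) l<m)

  opener-matched : ∀ i → toℕ i < toℕ (τ i) → Matched path i (τ i)
  opener-matched i i<τi =
    i<τi , trans (lookup∘tabulate stepOf i) (stepOf-opener i i<τi) ,
    trans (lookup∘tabulate stepOf (τ i)) (stepOf-partner i i<τi) , arc-balanced , prefix-dominated
    where
      a = toℕ i
      c = toℕ (τ i)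
      len-end : a + suc (c ∸ a) ≡ suc c
      len-end = trans (+-suc a (c ∸ a)) (cong suc (m+[n∸m]≡n (<⇒≤ i<τi)))
      arc-closed : ClosedInterval a (suc (c ∸ a))
      arc-closed j a≤j j<end = proj₁ τj-within , subst (toℕ (τ j) <_) (sym len-end) (s≤s (proj₂ τj-within))
        where
          τj-within : a ≤ toℕ (τ j) × toℕ (τ j) ≤ c
          τj-within with m≤n⇒m<n∨m≡n a≤j | m≤n⇒m<n∨m≡n (≤-pred (subst (toℕ j <_) len-end j<end))
          ... | inj₂ a≡j | _ rewrite toℕ-injective {i = i} {j = j} a≡j = <⇒≤ i<τi , ≤-refl
          ... | inj₁ _ | inj₂ j≡c rewrite toℕ-injective {i = j} {j = τ i} j≡c | τ-involutive i = ≤-refl , <⇒≤ i<τi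
          ... | inj₁ a<j | inj₁ j<c = let nested = τ-noncrossing i j a<j j<c in <⇒≤ (proj₁ nested) , <⇒≤ (proj₂ nested)
      arc-balanced : #u (segment path a c) ≡ #d (segment path a c)
      arc-balanced rewrite segment-path a c (<⇒≤ i<τi) (toℕ<n (τ i)) =
        sym (closed-balanced (suc (c ∸ a)) a (subst (_≤ m) (sym len-end) (toℕ<n (τ i))) arc-closed)
      prefix-dominated : ∀ l → a ≤ l → l < c → #d (segment path a l) < #u (segment path a l)
      prefix-dominated l a≤l l<c
        rewrite segment-path a l a≤l (<-trans l<c (toℕ<n (τ i))) | stepAt-toℕ i | stepOf-opener i i<τi =
        s≤s (noDownLeaves-dominated (l ∸ a) (suc a) (subst (_≤ m) (sym l-end) (<-trans l<c (toℕ<n (τ i))))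
               λ j a<j j<end _ → proj₁ (τ-noncrossing i j a<j (≤-<-trans (≤-pred (subst (toℕ j <_) l-end j<end)) l<c)))
        where
          l-end : suc a + (l ∸ a) ≡ suc l
          l-end = cong suc (m+[n∸m]≡n a≤l)

  Matched⇒τ : ∀ i j → Matched path i j → τ i ≡ j
  Matched⇒τ i j matched@(_ , step-i , _) with <-cmp (toℕ i) (toℕ (τ i))
  ... | tri< i<τi _ _ = Matched-functional path (opener-matched i i<τi) matched
  ... | tri≈ _ i≡τi _ = ⊥-elim (toℕ-τ≢ i (sym i≡τi))
  ... | tri> _ _ τi<i with trans (sym step-i) (trans (lookup∘tabulate stepOf i) (stepOf-closer i τi<i))
  ...   | ()

  path-tunneling : IsTunneling path τ
  path-tunneling i j = mk⇔ to from
    where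
      to : τ i ≡ j → Matched path i j ⊎ Matched path j i
      to refl with <-cmp (toℕ i) (toℕ (τ i))
      ... | tri< i<τi _ _ = inj₁ (opener-matched i i<τi)
      ... | tri≈ _ i≡τi _ = ⊥-elim (toℕ-τ≢ i (sym i≡τi))
      ... | tri> _ _ τi<i = inj₂ (subst (Matched path (τ i)) (τ-involutive i)
                                   (opener-matched (τ i) (subst (toℕ (τ i) <_) (sym (toℕ-ττ i)) τi<i)))
      from : Matched path i j ⊎ Matched path j i → τ i ≡ j
      from (inj₁ matched) = Matched⇒τ i j matched
      from (inj₂ matched) = trans (cong τ (sym (Matched⇒τ j i matched))) (τ-involutive j)

  prefix-path : ∀ k → k ≤ m → take k (toList path) ≡ map stepAt (interval 0 k)
  prefix-path k k≤m = take-drop≡map-nth 0 k (toList path) (subst (k ≤_) (sym (length-toList path)) k≤m)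

  path-balanced : #u (toList path) ≡ #d (toList path)
  path-balanced = subst (λ w → #u w ≡ #d w) (sym whole)
    (sym (closed-balanced m 0 ≤-refl (λ j _ _ → z≤n , toℕ<n (τ j))))
    where
      whole : toList path ≡ map stepAt (interval 0 m)
      whole = trans (sym (take-all m (toList path) (≤-reflexive (length-toList path)))) (prefix-path m ≤-refl)

  path-prefixes : ∀ k → #d (take k (toList path)) ≤ #u (take k (toList path))
  path-prefixes k with k ≤? m
  ... | yes k≤m = subst (λ w → #d w ≤ #u w) (sym (prefix-path k k≤m))
                    (noDownLeaves-dominated k 0 k≤m (λ _ _ _ _ → z≤n))
  ... | no k≰m  = subst (λ w → #d w ≤ #u w) (sym (take-all k (toList path) (subst (_≤ k) (sym (length-toList path)) (<⇒≤ (≰⇒> k≰m)))))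
                    (≤-reflexive (sym path-balanced))

-- Nested partial matchings

just≢nothing : ∀ {A : Set} {x : A} → just x ≢ nothing
just≢nothing ()

module _ {m : ℕ} where

  Symmetric : State m → Set
  Symmetric st = ∀ x y → st x ≡ just y → st y ≡ just x

  PartnersAmong : ℕ → (ℕ → Fin m) → State m → Set
  PartnersAmong k e st = ∀ x y → st x ≡ just y → ∃ λ j → j < k × y ≡ e j

  InjectiveBelow : ℕ → (ℕ → Fin m) → Set
  InjectiveBelow k e = ∀ a b → a < k → b < k → e a ≡ e b → a ≡ b

  -- For a total matching this says that no two arcs cross.
  NestedOn : ℕ → (ℕ → Fin m) → State m → Set
  NestedOn k e st = ∀ a b c → a < b → b < c → c < k → st (e a) ≡ just (e c) →
                    ∃ λ b′ → a < b′ × b′ < c × st (e b) ≡ just (e b′)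

  pair-left : ∀ st (a b : Fin m) → pair st a b a ≡ just b
  pair-left st a b with a ≟ a
  ... | yes _ = refl
  ... | no a≢a = ⊥-elim (a≢a refl)

  pair-right : ∀ st (a b : Fin m) → a ≢ b → pair st a b b ≡ just a
  pair-right st a b a≢b with b ≟ a | b ≟ b
  ... | yes b≡a | _     = ⊥-elim (a≢b (sym b≡a))
  ... | no _    | yes _ = refl
  ... | no _    | no b≢b = ⊥-elim (b≢b refl)

  pair-other : ∀ st (a b z : Fin m) → z ≢ a → z ≢ b → pair st a b z ≡ st z
  pair-other st a b z z≢a z≢b with z ≟ a | z ≟ b
  ... | yes z≡a | _       = ⊥-elim (z≢a z≡a)
  ... | no _    | yes z≡b = ⊥-elim (z≢b z≡b)
  ... | no _    | no _    = refl

  pair-cases : ∀ st (a b x y : Fin m) → pair st a b x ≡ just y →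
               (x ≡ a × y ≡ b) ⊎ (x ≡ b × y ≡ a) ⊎ (x ≢ a × x ≢ b × st x ≡ just y)
  pair-cases st a b x y eq with x ≟ a | x ≟ b
  ... | yes x≡a | _       = inj₁ (x≡a , just-injective (sym eq))
  ... | no _    | yes x≡b = inj₂ (inj₁ (x≡b , just-injective (sym eq)))
  ... | no x≢a  | no x≢b  = inj₂ (inj₂ (x≢a , x≢b , eq))

  pair-nothing : ∀ st (a b z : Fin m) → pair st a b z ≡ nothing → st z ≡ nothing
  pair-nothing st a b z eq with z ≟ a | z ≟ b
  pair-nothing st a b z () | yes _ | _
  pair-nothing st a b z () | no _  | yes _
  ... | no _ | no _ = eq

  paired-≢-unpaired : ∀ (st : State m) {x y z} → st x ≡ just z → st y ≡ nothing → x ≢ y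
  paired-≢-unpaired st x-paired y-unpaired refl = just≢nothing (trans (sym x-paired) y-unpaired)

  nested-extend-unpaired : ∀ k e st → NestedOn k e st → Symmetric st → st (e k) ≡ nothing → NestedOn (suc k) e st
  nested-extend-unpaired k e st nested sym-st last-unpaired a b c a<b b<c c<sk arc with m≤n⇒m<n∨m≡n (≤-pred c<sk)
  ... | inj₁ c<k  = nested a b c a<b b<c c<k arc
  ... | inj₂ refl = ⊥-elim (just≢nothing (trans (sym (sym-st _ _ arc)) last-unpaired))

  nested-prepend-unpaired : ∀ k e st → NestedOn k e st → Symmetric st → (e′ : ℕ → Fin m) →
                            st (e′ 0) ≡ nothing → (∀ j → e′ (suc j) ≡ e j) → NestedOn (suc k) e′ st
  nested-prepend-unpaired k e st nested sym-st e′ first-unpaired shift zero b c _ _ _ arc =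
    ⊥-elim (just≢nothing (trans (sym arc) first-unpaired))
  nested-prepend-unpaired k e st nested sym-st e′ first-unpaired shift (suc a) (suc b) (suc c) (s≤s a<b) (s≤s b<c) (s≤s c<k) arc
    with nested a b c a<b b<c c<k (subst₂ (λ x y → st x ≡ just y) (shift a) (shift c) arc)
  ... | b′ , a<b′ , b′<c , arc′ = suc b′ , s≤s a<b′ , s≤s b′<c ,
                                   subst₂ (λ x y → st x ≡ just y) (sym (shift b)) (sym (shift b′)) arc′

  nested-extend-pair : ∀ k e st → NestedOn k e st → Symmetric st → PartnersAmong k e st → InjectiveBelow (suc k) e →
                       st (e k) ≡ nothing → ∀ c₀ → c₀ < k → st (e c₀) ≡ nothing →
                       (∀ c → c₀ < c → c < k → st (e c) ≢ nothing) →
                       NestedOn (suc k) e (pair st (e k) (e c₀))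
  nested-extend-pair k e st nested sym-st partners inj s-unpaired c₀ c₀<k v-unpaired later-paired a b c a<b b<c c<sk arc =
    closing (m≤n⇒m<n∨m≡n (≤-pred c<sk)) (e a ≟ v)
    where
      s = e k
      v = e c₀
      st′ = pair st s v
      R = ∃ λ b′ → a < b′ × b′ < c × st′ (e b) ≡ just (e b′)
      b<k : b < k
      b<k = <-≤-trans b<c (≤-pred c<sk)
      a<k = <-trans a<b b<k
      ≢s : ∀ j → j < k → e j ≢ s
      ≢s j j<k eq = <-irrefl (inj j k (m<n⇒m<1+n j<k) ≤-refl eq) j<k
      old-partner : ∀ {y} → st (e b) ≡ just y → st′ (e b) ≡ just y
      old-partner b-paired = trans (pair-other st s v (e b) (≢s b b<k) (paired-≢-unpaired st b-paired v-unpaired)) b-paired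
      closing : c < k ⊎ c ≡ k → Dec (e a ≡ v) → R
      closing (inj₁ c<k) (yes a≡c₀) = ⊥-elim (<-irrefl (inj c k (m<n⇒m<1+n c<k) ≤-refl
        (just-injective (trans (sym arc) (trans (cong st′ a≡c₀) (pair-right st s v (≢-sym (≢s c₀ c₀<k))))))) c<k)
      closing (inj₁ c<k) (no a≢c₀) with nested a b c a<b b<c c<k (trans (sym (pair-other st s v (e a) (≢s a a<k) a≢c₀)) arc)
      ... | b′ , a<b′ , b′<c , arc′ = b′ , a<b′ , b′<c , old-partner arc′
      closing (inj₂ refl) (no a≢c₀) = ⊥-elim (just≢nothing (trans (sym (sym-st _ _ (trans (sym (pair-other st s v (e a) (≢s a a<k) a≢c₀)) arc))) s-unpaired))
      closing (inj₂ refl) (yes a≡c₀) = inner-partner (st (e b)) refl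
        where
          a≡c₀′ : a ≡ c₀
          a≡c₀′ = inj a c₀ (m<n⇒m<1+n a<k) (m<n⇒m<1+n c₀<k) a≡c₀
          c₀<b = subst (_< b) a≡c₀′ a<b
          inner-partner : (w : Maybe (Fin m)) → st (e b) ≡ w → R
          inner-partner nothing  b-unpaired = ⊥-elim (later-paired b c₀<b b<k b-unpaired)
          inner-partner (just y) b-paired with partners (e b) y b-paired
          ... | b″ , b″<k , refl with <-cmp b″ c₀
          ...   | tri< b″<c₀ _ _ = ⊥-elim (just≢nothing (trans (sym (proj₂ (proj₂ (proj₂ (nested b″ c₀ b b″<c₀ c₀<b b<k (sym-st _ _ b-paired)))))) v-unpaired))
          ...   | tri≈ _ b″≡c₀ _ = ⊥-elim (just≢nothing (trans (sym (sym-st _ _ (subst (λ t → st (e b) ≡ just (e t)) b″≡c₀ b-paired))) v-unpaired))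
          ...   | tri> _ _ c₀<b″ = b″ , subst (_< b″) (sym a≡c₀′) c₀<b″ , b″<k , old-partner b-paired

  nested-prepend-pair : ∀ k e st → NestedOn k e st → Symmetric st → PartnersAmong k e st →
                        (e′ : ℕ → Fin m) → (∀ j → e′ (suc j) ≡ e j) → InjectiveBelow (suc k) e′ →
                        st (e′ 0) ≡ nothing → ∀ c₀ → c₀ < k → st (e c₀) ≡ nothing →
                        (∀ c → c < c₀ → st (e c) ≢ nothing) →
                        NestedOn (suc k) e′ (pair st (e′ 0) (e c₀))
  nested-prepend-pair k e st nested sym-st partners e′ shift inj s-unpaired c₀ c₀<k v-unpaired earlier-paired
                      a (suc b) (suc c) a<sb (s≤s b<c) (s≤s c<k) arc = opening a a<sb arc
    where
      s = e′ 0
      v = e c₀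
      st′ = pair st s v
      b<k = <-trans b<c c<k
      inj-e : ∀ i j → i < k → j < k → e i ≡ e j → i ≡ j
      inj-e i j i<k j<k eq = suc-injective (inj (suc i) (suc j) (s≤s i<k) (s≤s j<k) (trans (shift i) (trans eq (sym (shift j)))))
      ≢s : ∀ j → j < k → e j ≢ s
      ≢s j j<k eq with inj (suc j) 0 (s≤s j<k) z<s (trans (shift j) eq)
      ... | ()
      old-partner : ∀ {y} → st (e b) ≡ just y → st′ (e′ (suc b)) ≡ just y
      old-partner b-paired = trans (cong st′ (shift b))
        (trans (pair-other st s v (e b) (≢s b b<k) (paired-≢-unpaired st b-paired v-unpaired)) b-paired)
      R : ℕ → Set
      R a = ∃ λ b′ → a < b′ × b′ < suc c × st′ (e′ (suc b)) ≡ just (e′ b′)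
      opening : ∀ a → a < suc b → st′ (e′ a) ≡ just (e′ (suc c)) → R a
      opening zero _ new-arc = inner-partner (st (e b)) refl
        where
          c≡c₀ : c ≡ c₀
          c≡c₀ = inj-e c c₀ c<k c₀<k (trans (sym (shift c)) (sym (just-injective (trans (sym (pair-left st s v)) new-arc))))
          b<c₀ = subst (b <_) c≡c₀ b<c
          inner-partner : (w : Maybe (Fin m)) → st (e b) ≡ w → R zero
          inner-partner nothing  b-unpaired = ⊥-elim (earlier-paired b b<c₀ b-unpaired)
          inner-partner (just y) b-paired with partners (e b) y b-paired
          ... | b″ , b″<k , refl with <-cmp b″ c₀
          ...   | tri< b″<c₀ _ _ = suc b″ , z<s , s≤s (subst (b″ <_) (sym c≡c₀) b″<c₀) ,
                                   trans (old-partner b-paired) (cong just (sym (shift b″)))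
          ...   | tri≈ _ b″≡c₀ _ = ⊥-elim (just≢nothing (trans (sym (sym-st _ _ (subst (λ t → st (e b) ≡ just (e t)) b″≡c₀ b-paired))) v-unpaired))
          ...   | tri> _ _ c₀<b″ = ⊥-elim (just≢nothing (trans (sym (proj₂ (proj₂ (proj₂ (nested b c₀ b″ b<c₀ c₀<b″ b″<k b-paired))))) v-unpaired))
      opening (suc a) (s≤s a<b) old-arc with e a ≟ v
      ... | yes a≡c₀ with inj 0 (suc c) z<s (s≤s c<k)
                            (just-injective (trans (sym (trans (cong st′ (trans (shift a) a≡c₀)) (pair-right st s v (≢-sym (≢s c₀ c₀<k))))) old-arc))
      ...   | ()
      opening (suc a) (s≤s a<b) old-arc | no a≢c₀
        with nested a b c a<b b<c c<k (trans (sym (pair-other st s v (e a) (≢s a (<-trans a<b b<k)) a≢c₀))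
                                        (subst₂ (λ x y → st′ x ≡ just y) (shift a) (shift c) old-arc))
      ... | b′ , a<b′ , b′<c , arc′ = suc b′ , s≤s a<b′ , s≤s b′<c , trans (old-partner arc′) (cong just (sym (shift b′)))

  nested-rotate : ∀ k e st → NestedOn k e st → Symmetric st → PartnersAmong k e st → InjectiveBelow k e →
                  (∀ j → j < k → ∃ λ y → st (e j) ≡ just y) →
                  (e′ : ℕ → Fin m) → (∀ j → suc j < k → e′ j ≡ e (suc j)) → (∀ j → suc j ≡ k → e′ j ≡ e 0) →
                  NestedOn k e′ st
  nested-rotate k e st nested sym-st partners inj total e′ shift wrap a b c a<b b<c c<k arc with suc c <? k
  ... | yes sc<k with nested (suc a) (suc b) (suc c) (s≤s a<b) (s≤s b<c) sc<k
                       (subst₂ (λ x y → st x ≡ just y) (shift a (<-trans (s≤s (<-trans a<b b<c)) sc<k)) (shift c sc<k) arc)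
  ...   | suc b′ , s≤s a<b′ , s≤s b′<c , arc′ = b′ , a<b′ , b′<c ,
            subst₂ (λ x y → st x ≡ just y) (sym (shift b (<-trans (s≤s b<c) sc<k))) (sym (shift b′ (<-trans (s≤s b′<c) sc<k))) arc′
  nested-rotate k e st nested sym-st partners inj total e′ shift wrap a b c a<b b<c c<k arc | no sc≮k =
    wrapped-partner (total (suc b) sb<k)
    where
      sc≡k : suc c ≡ k
      sc≡k = ≤-antisym c<k (≮⇒≥ sc≮k)
      sa<k = subst (suc a <_) sc≡k (s≤s (<-trans a<b b<c))
      sb<k = subst (suc b <_) sc≡k (s≤s b<c)
      last-arc : st (e (suc a)) ≡ just (e 0)
      last-arc = subst₂ (λ x y → st x ≡ just y) (shift a sa<k) (wrap c sc≡k) arc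
      wrapped-partner : (∃ λ y → st (e (suc b)) ≡ just y) → ∃ λ b′ → a < b′ × b′ < c × st (e′ b) ≡ just (e′ b′)
      wrapped-partner (y , b-paired) with partners _ _ b-paired
      ... | zero , _ , refl = ⊥-elim (<-irrefl (sym (suc-injective (inj (suc b) (suc a) sb<k sa<k
                                  (just-injective (trans (sym (sym-st _ _ b-paired)) (sym-st _ _ last-arc)))))) a<b)
      ... | suc r , sr<k , refl with <-cmp r a
      ...   | tri≈ _ r≡a _ = ⊥-elim (<-irrefl (inj 0 (suc b) (<-≤-trans z<s sa<k) sb<k
                (just-injective (trans (sym last-arc) (sym-st _ _ (subst (λ t → st (e (suc b)) ≡ just (e (suc t))) r≡a b-paired))))) z<s)
      ...   | tri> _ _ a<r = r , a<r , ≤-pred (subst (suc r <_) (sym sc≡k) sr<k) ,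
                             trans (cong st (shift b sb<k)) (trans b-paired (cong just (sym (shift r sr<k))))
      ...   | tri< r<a _ _ with nested 0 (suc r) (suc a) z<s (s≤s r<a) sa<k (sym-st _ _ last-arc)
      ...     | r′ , _ , r′<sa , r-arc = ⊥-elim (<-irrefl (inj r′ (suc b) (<-trans r′<sa sa<k) sb<k
                  (just-injective (trans (sym r-arc) (sym-st _ _ b-paired)))) (<-trans r′<sa (s≤s a<b)))

-- The Inverse Algorithm

countBelow : (ℕ → Bool) → ℕ → ℕ
countBelow h zero    = 0
countBelow h (suc k) = (if h k then 1 else 0) + countBelow h k

countBelow-positive : ∀ h k → 0 < countBelow h k → ∃ λ i → i < k × h i ≡ true
countBelow-positive h (suc k) pos with h k in hk
... | true  = k , ≤-refl , hk
... | false with countBelow-positive h k pos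
...   | i , i<k , hi = i , m<n⇒m<1+n i<k , hi

countBelow-zero : ∀ h k → countBelow h k ≡ 0 → ∀ i → i < k → h i ≡ false
countBelow-zero h (suc k) zero-count i i<sk with h k in hk | m≤n⇒m<n∨m≡n (≤-pred i<sk)
countBelow-zero h (suc k) ()         i i<sk | true  | _
... | false | inj₁ i<k  = countBelow-zero h k zero-count i i<k
... | false | inj₂ refl = hk

countBelow-unset : ∀ h h′ k j → j < k → h j ≡ true → h′ j ≡ false → (∀ i → i < k → i ≢ j → h′ i ≡ h i) →
                   countBelow h′ k + 1 ≡ countBelow h k
countBelow-unset h h′ (suc k) j j<sk hj h′j agree with m≤n⇒m<n∨m≡n (≤-pred j<sk)
... | inj₂ refl rewrite hj | h′j = trans (+-comm (countBelow h′ j) 1) (cong suc (unchanged j ≤-refl))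
  where
    unchanged : ∀ k′ → k′ ≤ j → countBelow h′ k′ ≡ countBelow h k′
    unchanged zero     _      = refl
    unchanged (suc k′) k′<j = cong₂ _+_ (cong (λ b → if b then 1 else 0) (agree k′ (m<n⇒m<1+n k′<j) (<⇒≢ k′<j)))
                                        (unchanged k′ (<⇒≤ k′<j))
... | inj₁ j<k = trans (+-assoc (if h′ k then 1 else 0) (countBelow h′ k) 1)
                   (cong₂ _+_ (cong (λ b → if b then 1 else 0) (agree k ≤-refl (≢-sym (<⇒≢ j<k))))
                              (countBelow-unset h h′ k j j<k hj h′j (λ i i<k → agree i (m<n⇒m<1+n i<k))))

module _ {m : ℕ} (p : Fin m → Bool) where

  firstWith-just : ∀ f k {v} → firstWith p (applyUpTo f k) ≡ just v →
                   ∃ λ j → j < k × v ≡ f j × p (f j) ≡ true × (∀ j′ → j′ < j → p (f j′) ≡ false)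
  firstWith-just f (suc k) found with p (f 0) in p0
  ... | true  = 0 , z<s , just-injective (sym found) , p0 , λ _ ()
  ... | false with firstWith-just (λ j → f (suc j)) k found
  ...   | j , j<k , v≡ , pj , before = suc j , s≤s j<k , v≡ , pj , before′
    where
      before′ : ∀ j′ → j′ < suc j → p (f j′) ≡ false
      before′ zero     _          = p0
      before′ (suc j′) (s≤s j′<j) = before j′ j′<j

  firstWith-nothing : ∀ f k → firstWith p (applyUpTo f k) ≡ nothing → ∀ j → j < k → p (f j) ≡ false
  firstWith-nothing f (suc k) none j j<k with p (f 0) in p0
  firstWith-nothing f (suc k) ()   j       j<k       | true
  firstWith-nothing f (suc k) none zero    _         | false = p0
  firstWith-nothing f (suc k) none (suc j) (s≤s j<k) | false = firstWith-nothing (λ j → f (suc j)) k none j j<k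

module _ {m : ℕ} (st : State m) (x : Fin m) where

  isUnpaired-nothing : st x ≡ nothing → isUnpaired st x ≡ true
  isUnpaired-nothing eq rewrite eq = refl

  isUnpaired-just : ∀ {y} → st x ≡ just y → isUnpaired st x ≡ false
  isUnpaired-just eq rewrite eq = refl

  isUnpaired-true : isUnpaired st x ≡ true → st x ≡ nothing
  isUnpaired-true eq with st x
  ... | nothing = refl
  isUnpaired-true () | just _

  isUnpaired-false : isUnpaired st x ≡ false → st x ≢ nothing
  isUnpaired-false eq unpaired rewrite unpaired with eq
  ... | ()

isUnpaired-cong : ∀ {m} (st st′ : State m) x → st′ x ≡ st x → isUnpaired st′ x ≡ isUnpaired st x
isUnpaired-cong st st′ x eq with st′ x | st x
... | nothing | nothing = refl
... | just _  | just _  = refl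
isUnpaired-cong st st′ x () | nothing | just _
isUnpaired-cong st st′ x () | just _  | nothing

isYes-true : ∀ {A : Set} (a? : Dec A) → A → ⌊ a? ⌋ ≡ true
isYes-true a? a = trans (isYes≗does a?) (dec-true a? a)

isYes-false : ∀ {A : Set} (a? : Dec A) → ¬ A → ⌊ a? ⌋ ≡ false
isYes-false a? ¬a = trans (isYes≗does a?) (dec-false a? ¬a)

mirror : ℕ → ℕ → ℕ
mirror k j = k ∸ suc j

mirror-mirror : ∀ {j k} → j < k → mirror k (mirror k j) ≡ j
mirror-mirror {j} {suc k} (s≤s j≤k) = m∸[m∸n]≡n j≤k

mirror-< : ∀ {j k} → j < k → mirror k j < k
mirror-< {j} {suc k} _ = s≤s (m∸n≤m k j)

mirror-antitone : ∀ {i j k} → i < j → j < k → mirror k j < mirror k i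
mirror-antitone i<j j<k = ∸-monoʳ-< (s≤s i<j) j<k

module Blocks {M : ℕ} (σ : Permutation′ (suc M)) where
  private
    m = suc M

  σ⟨_⟩ : Fin m → Fin m
  σ⟨ i ⟩ = σ ⟨$⟩ʳ i

  σ-injective : ∀ {i j} → σ⟨ i ⟩ ≡ σ⟨ j ⟩ → i ≡ j
  σ-injective {i} {j} eq = trans (sym (inverseˡ σ)) (trans (cong (σ ⟨$⟩ˡ_) eq) (inverseˡ σ))

  σ-inverse : ∀ x → σ⟨ σ ⟨$⟩ˡ x ⟩ ≡ x
  σ-inverse x = inverseʳ σ

  InPrefix⇒< : ∀ {k i} → InPrefix σ k σ⟨ i ⟩ → toℕ i < k
  InPrefix⇒< (j , j<k , eq) = subst (λ t → toℕ t < _) (σ-injective eq) j<k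

  σ∉own-prefix : ∀ i → ¬ InPrefix σ (toℕ i) σ⟨ i ⟩
  σ∉own-prefix i p = <-irrefl refl (InPrefix⇒< p)

  σ∈next-prefix : ∀ i → InPrefix σ (suc (toℕ i)) σ⟨ i ⟩
  σ∈next-prefix i = i , ≤-refl , refl

  InPrefix-mono : ∀ {k k′ y} → k ≤ k′ → InPrefix σ k y → InPrefix σ k′ y
  InPrefix-mono k≤k′ (j , j<k , eq) = j , <-≤-trans j<k k≤k′ , eq

  InPrefix-suc : ∀ i {y} → InPrefix σ (suc (toℕ i)) y → InPrefix σ (toℕ i) y ⊎ y ≡ σ⟨ i ⟩
  InPrefix-suc i (j , j<si , eq) with m≤n⇒m<n∨m≡n (≤-pred j<si)
  ... | inj₁ j<i = inj₁ (j , j<i , eq)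
  ... | inj₂ j≡i = inj₂ (trans (sym eq) (cong σ⟨_⟩ (toℕ-injective j≡i)))

  PrefixBlock : ℕ → Fin m → Set
  PrefixBlock k L = ∀ y → InPrefix σ k y ⇔ (∃ λ j → j < k × y ≡ addMod L j)

  open Equivalence


  PrefixBlock-unique : ∀ k L L′ → 0 < k → k < m → PrefixBlock k L → PrefixBlock k L′ → L ≡ L′
  PrefixBlock-unique k L L′ 0<k k<m block block′ with to (block′ L) (from (block L) (0 , 0<k , sym (addMod-identityʳ L)))
  ... | zero , _ , L≡ = trans L≡ (addMod-identityʳ L′)
  ... | suc a , a<k , L≡ with to (block (addMod L′ a)) (from (block′ (addMod L′ a)) (a , <-trans (n<1+n a) a<k , refl))
  ...   | b , b<k , L′a≡ = ⊥-elim (<-irrefl (sym M≡b) (<-≤-trans b<k (≤-pred k<m)))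
    where
      M≡b : M ≡ b
      M≡b = addMod-injective L ≤-refl (<-trans b<k k<m)
              (trans (trans (cong (λ t → subMod t 1) L≡) (subMod-addMod L′ a (s≤s z≤n))) L′a≡)

  block-extend-right : ∀ i L → PrefixBlock (toℕ i) L → InPrefix σ (toℕ i) (subMod σ⟨ i ⟩ 1) →
                       σ⟨ i ⟩ ≡ addMod L (toℕ i) × PrefixBlock (suc (toℕ i)) L
  block-extend-right i L block left-neighbour with to (block _) left-neighbour
  ... | a , a<k , neighbour≡ = σi≡ , block′
    where
      k = toℕ i
      σi≡L+sa : σ⟨ i ⟩ ≡ addMod L (suc a)
      σi≡L+sa = begin
        σ⟨ i ⟩                               ≡⟨ sym (addMod-subMod σ⟨ i ⟩ (s≤s z≤n)) ⟩
        addMod (subMod σ⟨ i ⟩ 1) 1           ≡⟨ cong (λ t → addMod t 1) neighbour≡ ⟩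
        addMod (addMod L a) 1                ≡⟨ addMod-addMod L a 1 ⟩
        addMod L (a + 1)                     ≡⟨ cong (addMod L) (+-comm a 1) ⟩
        addMod L (suc a)                     ∎
        where open ≡-Reasoning
      sa≡k : suc a ≡ k
      sa≡k with suc a <? k
      ... | yes sa<k = ⊥-elim (σ∉own-prefix i (from (block _) (suc a , sa<k , σi≡L+sa)))
      ... | no sa≮k  = ≤-antisym a<k (≮⇒≥ sa≮k)
      σi≡ : σ⟨ i ⟩ ≡ addMod L k
      σi≡ = trans σi≡L+sa (cong (addMod L) sa≡k)
      block′ : PrefixBlock (suc k) L
      block′ y = mk⇔ ⇒ ⇐
        where
          ⇒ : InPrefix σ (suc k) y → ∃ λ j → j < suc k × y ≡ addMod L j
          ⇒ p with InPrefix-suc i p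
          ... | inj₁ q    = let (j , j<k , y≡) = to (block y) q in j , m<n⇒m<1+n j<k , y≡
          ... | inj₂ y≡σi = k , ≤-refl , trans y≡σi σi≡
          ⇐ : (∃ λ j → j < suc k × y ≡ addMod L j) → InPrefix σ (suc k) y
          ⇐ (j , j<sk , y≡) with m≤n⇒m<n∨m≡n (≤-pred j<sk)
          ... | inj₁ j<k  = InPrefix-mono (n≤1+n k) (from (block y) (j , j<k , y≡))
          ... | inj₂ refl = subst (InPrefix σ (suc k)) (trans σi≡ (sym y≡)) (σ∈next-prefix i)

  block-extend-left : ∀ i → IsCCP σ → ¬ InPrefix σ (toℕ i) (subMod σ⟨ i ⟩ 1) →
                      PrefixBlock (suc (toℕ i)) σ⟨ i ⟩ × PrefixBlock (toℕ i) (addMod σ⟨ i ⟩ 1)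
  block-extend-left i ccp no-left-neighbour = block-from-σi , block-from-next
    where
      k = toℕ i
      s = σ⟨ i ⟩
      L = proj₁ (ccp (suc k) (s≤s z≤n) (toℕ<n i))
      block = proj₂ (ccp (suc k) (s≤s z≤n) (toℕ<n i))
      s≡L : s ≡ L
      s≡L with to (block s) (σ∈next-prefix i)
      ... | zero , _ , s≡ = trans s≡ (addMod-identityʳ L)
      ... | suc j , sj<sk , s≡ with InPrefix-suc i (from (block (addMod L j)) (j , <-trans (n<1+n j) sj<sk , refl))
      ...   | inj₁ in-prefix = ⊥-elim (no-left-neighbour (subst (InPrefix σ k)
                                 (sym (trans (cong (λ t → subMod t 1) s≡) (subMod-addMod L j (s≤s z≤n)))) in-prefix))
      ...   | inj₂ Lj≡s = ⊥-elim (<-irrefl (addMod-injective L (<-trans (n<1+n j) sj<m) sj<m (trans Lj≡s s≡)) (n<1+n j))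
        where sj<m = <-≤-trans sj<sk (toℕ<n i)
      block-from-σi : PrefixBlock (suc k) s
      block-from-σi = subst (PrefixBlock (suc k)) (sym s≡L) block
      block-from-next : PrefixBlock k (addMod s 1)
      block-from-next y = mk⇔ ⇒ ⇐
        where
          ⇒ : InPrefix σ k y → ∃ λ j → j < k × y ≡ addMod (addMod s 1) j
          ⇒ p with to (block-from-σi y) (InPrefix-mono (n≤1+n k) p)
          ... | zero  , _         , y≡ = ⊥-elim (σ∉own-prefix i (subst (InPrefix σ k) (trans y≡ (addMod-identityʳ s)) p))
          ... | suc j , s≤s j<k , y≡ = j , j<k , trans y≡ (sym (addMod-addMod s 1 j))
          ⇐ : (∃ λ j → j < k × y ≡ addMod (addMod s 1) j) → InPrefix σ k y
          ⇐ (j , j<k , y≡) with InPrefix-suc i (from (block-from-σi y) (suc j , s≤s j<k , trans y≡ (addMod-addMod s 1 j)))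
          ... | inj₁ q    = q
          ... | inj₂ y≡s with addMod-injective s (<-≤-trans (s≤s j<k) (toℕ<n i)) (<-≤-trans z<s (toℕ<n i))
                                (trans (sym (trans y≡ (addMod-addMod s 1 j))) (trans y≡s (sym (addMod-identityʳ s))))
          ...   | ()

module AlgorithmRun {M : ℕ} (σ : Permutation′ (suc M)) (ccp : IsCCP σ) (P : Vec Step (suc M))
  (P-prefixes : ∀ k → #d (take k (toList P)) ≤ #u (take k (toList P))) where
  open Blocks σ
  open Equivalence
  private
    m = suc M
    prefix : ℕ → List Step
    prefix k = take k (toList P)

  prefix-suc : ∀ i → prefix (suc (toℕ i)) ≡ prefix (toℕ i) ++ lookup P i ∷ []
  prefix-suc = take-suc-toList P

  -- The default false beyond m is never observed.
  unpairedAt : State m → ℕ → Bool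
  unpairedAt st i with i <? m
  ... | yes i<m = isUnpaired st σ⟨ fromℕ< i<m ⟩
  ... | no _    = false

  unpairedAt-toℕ : ∀ st i → unpairedAt st (toℕ i) ≡ isUnpaired st σ⟨ i ⟩
  unpairedAt-toℕ st i with toℕ i <? m
  ... | yes i<m = cong (λ j → isUnpaired st σ⟨ j ⟩) (fromℕ<-toℕ i i<m)
  ... | no i≮m  = ⊥-elim (i≮m (toℕ<n i))

  -- partner-side is the condition σ(Q)_i = P_i, recorded as soon as σ_i is paired.
  record StateInvariant (k : ℕ) (st : State m) : Set where
    field
      paired-InPrefix : ∀ x y → st x ≡ just y → InPrefix σ k x × InPrefix σ k y
      symmetric       : Symmetric st
      partner-side    : ∀ i y → st σ⟨ i ⟩ ≡ just y →
                        (lookup P i ≡ d → InPrefix σ (toℕ i) y) × (lookup P i ≡ u → ¬ InPrefix σ (suc (toℕ i)) y)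
      downs-paired    : ∀ i → toℕ i < k → lookup P i ≡ d → st σ⟨ i ⟩ ≢ nothing
      unpaired-count  : countBelow (unpairedAt st) k + #d (prefix k) ≡ #u (prefix k)
      left            : Fin m
      block           : PrefixBlock k left
      nested          : NestedOn k (addMod left) st

  module _ {k : ℕ} {st : State m} (I : StateInvariant k st) where
    open StateInvariant I

    irreflexive : ∀ x → st x ≢ just x
    irreflexive x loop with lookup P (σ ⟨$⟩ˡ x) | partner-side (σ ⟨$⟩ˡ x) x (subst (λ t → st t ≡ just x) (sym (σ-inverse x)) loop)
    ... | d | (earlier , _) = σ∉own-prefix (σ ⟨$⟩ˡ x) (subst (InPrefix σ _) (sym (σ-inverse x)) (earlier refl))
    ... | u | (_ , not-yet) = not-yet refl (subst (InPrefix σ _) (σ-inverse x) (σ∈next-prefix (σ ⟨$⟩ˡ x)))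

    partners-among : PartnersAmong k (addMod left) st
    partners-among x y paired = to (block y) (proj₂ (paired-InPrefix x y paired))

  nested-transport : ∀ k L L′ st → k < m → PrefixBlock k L → PrefixBlock k L′ →
                     NestedOn k (addMod L) st → NestedOn k (addMod L′) st
  nested-transport zero    _ _  _  _   _     _      _      a b c _ _ ()
  nested-transport (suc k) L L′ st k<m block block′ nested =
    subst (λ L → NestedOn (suc k) (addMod L) st) (PrefixBlock-unique (suc k) L L′ z<s k<m block block′) nested

  traversal-applyUpTo : ∀ i → traversal σ i ≡
    applyUpTo (λ j → if ⌊ inPrefix? σ (toℕ i) (subMod σ⟨ i ⟩ 1) ⌋ then subMod σ⟨ i ⟩ (suc j) else addMod σ⟨ i ⟩ (suc j)) (toℕ i)
  traversal-applyUpTo i = trans (cong (map _) (map-applyUpTo (λ x → x) suc (toℕ i))) (map-applyUpTo suc _ (toℕ i))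

  traversal-leftward : ∀ i → InPrefix σ (toℕ i) (subMod σ⟨ i ⟩ 1) →
                       traversal σ i ≡ applyUpTo (λ j → subMod σ⟨ i ⟩ (suc j)) (toℕ i)
  traversal-leftward i left-neighbour rewrite traversal-applyUpTo i
    | isYes-true (inPrefix? σ (toℕ i) (subMod σ⟨ i ⟩ 1)) left-neighbour = refl

  traversal-rightward : ∀ i → ¬ InPrefix σ (toℕ i) (subMod σ⟨ i ⟩ 1) →
                        traversal σ i ≡ applyUpTo (λ j → addMod σ⟨ i ⟩ (suc j)) (toℕ i)
  traversal-rightward i no-left-neighbour rewrite traversal-applyUpTo i
    | isYes-false (inPrefix? σ (toℕ i) (subMod σ⟨ i ⟩ 1)) no-left-neighbour = refl

  σ-unpaired : ∀ i {st} → StateInvariant (toℕ i) st → st σ⟨ i ⟩ ≡ nothing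
  σ-unpaired i {st} I with st σ⟨ i ⟩ in eq
  ... | nothing = refl
  ... | just y  = ⊥-elim (σ∉own-prefix i (proj₁ (StateInvariant.paired-InPrefix I _ _ eq)))

  module _ (i : Fin m) {st : State m} (I : StateInvariant (toℕ i) st) where
    open StateInvariant I
    private
      k = toℕ i
      s = σ⟨ i ⟩

    up-step : lookup P i ≡ u → (L : Fin m) → PrefixBlock (suc k) L → NestedOn (suc k) (addMod L) st →
              StateInvariant (suc k) st
    up-step Pi≡u L block′ nested′ = record
      { paired-InPrefix = λ x y paired → let (x∈ , y∈) = paired-InPrefix x y paired in
                                          InPrefix-mono (n≤1+n k) x∈ , InPrefix-mono (n≤1+n k) y∈
      ; symmetric       = symmetric
      ; partner-side    = partner-side
      ; downs-paired    = downs-paired′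
      ; unpaired-count  = count′
      ; left            = L
      ; block           = block′
      ; nested          = nested′ }
      where
        open ≡-Reasoning
        downs-paired′ : ∀ j → toℕ j < suc k → lookup P j ≡ d → st σ⟨ j ⟩ ≢ nothing
        downs-paired′ j j<sk Pj≡d with m≤n⇒m<n∨m≡n (≤-pred j<sk)
        ... | inj₁ j<k = downs-paired j j<k Pj≡d
        ... | inj₂ j≡k with toℕ-injective {i = j} {j = i} j≡k
        ...   | refl with trans (sym Pi≡u) Pj≡d
        ...     | ()
        C = countBelow (unpairedAt st) k
        count′ : countBelow (unpairedAt st) (suc k) + #d (prefix (suc k)) ≡ #u (prefix (suc k))
        count′ rewrite prefix-suc i | Pi≡u | unpairedAt-toℕ st i | isUnpaired-nothing st s (σ-unpaired i I) = begin
          suc C + #d (prefix k ++ u ∷ [])   ≡⟨ cong (suc C +_) (#d-snoc-u (prefix k)) ⟩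
          suc (C + #d (prefix k))           ≡⟨ cong suc unpaired-count ⟩
          suc (#u (prefix k))               ≡⟨ sym (#u-snoc-u (prefix k)) ⟩
          #u (prefix k ++ u ∷ [])           ∎

    module Pairing (Pi≡d : lookup P i ≡ d) (v : Fin m) (v-InPrefix : InPrefix σ k v) (v-unpaired : st v ≡ nothing) where
      st′ = pair st s v
      s-unpaired = σ-unpaired i I
      s≢v : s ≢ v
      s≢v s≡v = σ∉own-prefix i (subst (InPrefix σ k) (sym s≡v) v-InPrefix)
      grow : ∀ {y} → InPrefix σ k y → InPrefix σ (suc k) y
      grow = InPrefix-mono (n≤1+n k)
      paired-InPrefix′ : ∀ x y → st′ x ≡ just y → InPrefix σ (suc k) x × InPrefix σ (suc k) y
      paired-InPrefix′ x y paired with pair-cases st s v x y paired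
      ... | inj₁ (refl , refl)        = σ∈next-prefix i , grow v-InPrefix
      ... | inj₂ (inj₁ (refl , refl)) = grow v-InPrefix , σ∈next-prefix i
      ... | inj₂ (inj₂ (_ , _ , old)) = let (x∈ , y∈) = paired-InPrefix x y old in grow x∈ , grow y∈
      symmetric′ : Symmetric st′
      symmetric′ x y paired with pair-cases st s v x y paired
      ... | inj₁ (refl , refl)        = pair-right st s v s≢v
      ... | inj₂ (inj₁ (refl , refl)) = pair-left st s v
      ... | inj₂ (inj₂ (_ , _ , old)) = trans (pair-other st s v y
                                                (paired-≢-unpaired st (symmetric x y old) s-unpaired)
                                                (paired-≢-unpaired st (symmetric x y old) v-unpaired))
                                              (symmetric x y old)
      partner-side′ : ∀ j y → st′ σ⟨ j ⟩ ≡ just y →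
                      (lookup P j ≡ d → InPrefix σ (toℕ j) y) × (lookup P j ≡ u → ¬ InPrefix σ (suc (toℕ j)) y)
      partner-side′ j y paired with pair-cases st s v σ⟨ j ⟩ y paired
      ... | inj₁ (σj≡s , refl) with σ-injective {j} {i} σj≡s
      ...   | refl = (λ _ → v-InPrefix) , (λ Pi≡u → ⊥-elim (u≢d (trans (sym Pi≡u) Pi≡d)))
        where u≢d : u ≢ d
              u≢d ()
      partner-side′ j y paired | inj₂ (inj₁ (σj≡v , refl)) =
        (λ Pj≡d → ⊥-elim (downs-paired j j<k Pj≡d (trans (cong st σj≡v) v-unpaired))) ,
        (λ _ s∈ → <-irrefl refl (≤-<-trans (≤-pred (InPrefix⇒< s∈)) j<k))
        where j<k = InPrefix⇒< (subst (InPrefix σ k) (sym σj≡v) v-InPrefix)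
      partner-side′ j y paired | inj₂ (inj₂ (_ , _ , old)) = partner-side j y old
      downs-paired′ : ∀ j → toℕ j < suc k → lookup P j ≡ d → st′ σ⟨ j ⟩ ≢ nothing
      downs-paired′ j j<sk Pj≡d with m≤n⇒m<n∨m≡n (≤-pred j<sk)
      ... | inj₁ j<k = λ unpaired → downs-paired j j<k Pj≡d (pair-nothing st s v σ⟨ j ⟩ unpaired)
      ... | inj₂ j≡k with toℕ-injective {i = j} {j = i} j≡k
      ...   | refl = λ unpaired → just≢nothing (trans (sym (pair-left st s v)) unpaired)
      v-index = σ ⟨$⟩ˡ v
      v-index<k : toℕ v-index < k
      v-index<k = InPrefix⇒< (subst (InPrefix σ k) (sym (σ-inverse v)) v-InPrefix)
      one-fewer : countBelow (unpairedAt st′) k + 1 ≡ countBelow (unpairedAt st) k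
      one-fewer = countBelow-unset (unpairedAt st) (unpairedAt st′) k (toℕ v-index) v-index<k
        (trans (unpairedAt-toℕ st v-index) (trans (cong (isUnpaired st) (σ-inverse v)) (isUnpaired-nothing st v v-unpaired)))
        (trans (unpairedAt-toℕ st′ v-index) (trans (cong (isUnpaired st′) (σ-inverse v)) (isUnpaired-just st′ v (pair-right st s v s≢v))))
        unchanged
        where
          unchanged : ∀ j → j < k → j ≢ toℕ v-index → unpairedAt st′ j ≡ unpairedAt st j
          unchanged j j<k j≢v with fromℕ< (<-trans j<k (toℕ<n i)) | toℕ-fromℕ< (<-trans j<k (toℕ<n i))
          ... | j′ | refl = trans (unpairedAt-toℕ st′ j′)
                              (trans (isUnpaired-cong st st′ σ⟨ j′ ⟩ (pair-other st s v σ⟨ j′ ⟩ σj≢s σj≢v))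
                                     (sym (unpairedAt-toℕ st j′)))
            where
              σj≢s : σ⟨ j′ ⟩ ≢ s
              σj≢s eq = <-irrefl (cong toℕ (σ-injective eq)) j<k
              σj≢v : σ⟨ j′ ⟩ ≢ v
              σj≢v eq = j≢v (cong toℕ (σ-injective (trans eq (sym (σ-inverse v)))))
      C′ = countBelow (unpairedAt st′) k
      count′ : countBelow (unpairedAt st′) (suc k) + #d (prefix (suc k)) ≡ #u (prefix (suc k))
      count′ rewrite prefix-suc i | Pi≡d | unpairedAt-toℕ st′ i | isUnpaired-just st′ s (pair-left st s v) = begin
          C′ + #d (prefix k ++ d ∷ [])         ≡⟨ cong (C′ +_) (#d-snoc-d (prefix k)) ⟩
          C′ + suc (#d (prefix k))             ≡⟨ sym (+-assoc C′ 1 _) ⟩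
          C′ + 1 + #d (prefix k)               ≡⟨ cong (_+ #d (prefix k)) one-fewer ⟩
          countBelow (unpairedAt st) k + #d (prefix k) ≡⟨ unpaired-count ⟩
          #u (prefix k)                        ≡⟨ sym (#u-snoc-d (prefix k)) ⟩
          #u (prefix k ++ d ∷ [])              ∎
        where open ≡-Reasoning

    down-step : lookup P i ≡ d → ∀ v → InPrefix σ k v → st v ≡ nothing →
                (L : Fin m) → PrefixBlock (suc k) L → NestedOn (suc k) (addMod L) (pair st s v) →
                StateInvariant (suc k) (pair st s v)
    down-step Pi≡d v v-InPrefix v-unpaired L block′ nested′ = record
      { paired-InPrefix = paired-InPrefix′
      ; symmetric       = symmetric′
      ; partner-side    = partner-side′
      ; downs-paired    = downs-paired′
      ; unpaired-count  = count′
      ; left            = L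
      ; block           = block′
      ; nested          = nested′ }
      where open Pairing Pi≡d v v-InPrefix v-unpaired

    unpaired-exists : lookup P i ≡ d → ∃ λ x → InPrefix σ k x × st x ≡ nothing
    unpaired-exists Pi≡d with countBelow-positive (unpairedAt st) k some-unpaired
      where
        some-unpaired : 0 < countBelow (unpairedAt st) k
        some-unpaired = +-cancelʳ-≤ (#d (prefix k)) 1 _ (begin
          1 + #d (prefix k)                              ≡⟨ sym (#d-snoc-d (prefix k)) ⟩
          #d (prefix k ++ d ∷ [])                        ≡⟨ cong (λ w → #d (prefix k ++ w ∷ [])) (sym Pi≡d) ⟩
          #d (prefix k ++ lookup P i ∷ [])               ≡⟨ cong #d (sym (prefix-suc i)) ⟩
          #d (prefix (suc k))                            ≤⟨ P-prefixes (suc k) ⟩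
          #u (prefix (suc k))                            ≡⟨ cong #u (prefix-suc i) ⟩
          #u (prefix k ++ lookup P i ∷ [])               ≡⟨ cong (λ w → #u (prefix k ++ w ∷ [])) Pi≡d ⟩
          #u (prefix k ++ d ∷ [])                        ≡⟨ #u-snoc-d (prefix k) ⟩
          #u (prefix k)                                  ≡⟨ sym unpaired-count ⟩
          countBelow (unpairedAt st) k + #d (prefix k)   ∎)
          where open ≤-Reasoning
    ... | j , j<k , unpaired with toℕ-preimage (<-trans j<k (toℕ<n i))
    ...   | j′ , refl = σ⟨ j′ ⟩ , (j′ , j<k , refl) , isUnpaired-true st σ⟨ j′ ⟩ (trans (sym (unpairedAt-toℕ st j′)) unpaired)

    injective-from : ∀ L → InjectiveBelow (suc k) (addMod L)
    injective-from L a b a<sk b<sk = addMod-injective L (<-≤-trans a<sk (toℕ<n i)) (<-≤-trans b<sk (toℕ<n i))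

    round-up : lookup P i ≡ u → StateInvariant (suc k) st
    round-up Pi≡u with inPrefix? σ k (subMod s 1)
    ... | yes left-neighbour = up-step Pi≡u left (proj₂ geometry)
            (nested-extend-unpaired k (addMod left) st nested symmetric
              (subst (λ t → st t ≡ nothing) (proj₁ geometry) (σ-unpaired i I)))
      where geometry = block-extend-right i left block left-neighbour
    ... | no no-left-neighbour = up-step Pi≡u s (proj₁ geometry)
            (nested-prepend-unpaired k (addMod (addMod s 1)) st
              (nested-transport k left (addMod s 1) st (toℕ<n i) block (proj₂ geometry) nested) symmetric
              (addMod s) (trans (cong st (addMod-identityʳ s)) (σ-unpaired i I)) (λ j → sym (addMod-addMod s 1 j)))
      where geometry = block-extend-left i ccp no-left-neighbour

    round-down-rightmost : lookup P i ≡ d → InPrefix σ k (subMod s 1) →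
                           StateInvariant (suc k) (pairWith st s (firstWith (isUnpaired st) (traversal σ i)))
    round-down-rightmost Pi≡d left-neighbour rewrite traversal-leftward i left-neighbour =
      first-unpaired (firstWith (isUnpaired st) (applyUpTo candidate k)) refl
      where
        geometry = block-extend-right i left block left-neighbour
        s≡ = proj₁ geometry
        candidate : ℕ → Fin m
        candidate j = subMod s (suc j)
        candidate≡ : ∀ j → j < k → candidate j ≡ addMod left (mirror k j)
        candidate≡ j j<k = begin
          subMod s (suc j)                                 ≡⟨ cong (λ t → subMod t (suc j)) s≡ ⟩
          subMod (addMod left k) (suc j)                   ≡⟨ cong (λ t → subMod (addMod left t) (suc j)) (sym (m+[n∸m]≡n j<k)) ⟩
          subMod (addMod left (suc j + (k ∸ suc j))) (suc j) ≡⟨ subMod-addMod left (k ∸ suc j) (<-trans j<k (toℕ<n i)) ⟩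
          addMod left (k ∸ suc j)                          ∎
          where open ≡-Reasoning
        candidate-mirror : ∀ j → j < k → candidate (mirror k j) ≡ addMod left j
        candidate-mirror j j<k = trans (candidate≡ _ (mirror-< j<k)) (cong (addMod left) (mirror-mirror j<k))
        first-unpaired : (r : Maybe (Fin m)) → firstWith (isUnpaired st) (applyUpTo candidate k) ≡ r →
                         StateInvariant (suc k) (pairWith st s r)
        first-unpaired nothing none with unpaired-exists Pi≡d
        ... | x , x∈ , x-unpaired with to (block x) x∈
        ...   | j , j<k , x≡ = ⊥-elim (isUnpaired-false st _ (firstWith-nothing (isUnpaired st) candidate k none _ (mirror-< j<k))
                                 (subst (λ t → st t ≡ nothing) (trans x≡ (sym (candidate-mirror j j<k))) x-unpaired))
        first-unpaired (just v) first with firstWith-just (isUnpaired st) candidate k first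
        ... | j , j<k , refl , v-free , before =
          down-step Pi≡d v (from (block v) (c₀ , mirror-< j<k , v≡)) v-unpaired left (proj₂ geometry)
            (subst₂ (λ a b → NestedOn (suc k) (addMod left) (pair st a b)) (sym s≡) (sym v≡)
              (nested-extend-pair k (addMod left) st nested symmetric (partners-among I) (injective-from left)
                (subst (λ t → st t ≡ nothing) s≡ (σ-unpaired i I)) c₀ (mirror-< j<k)
                (subst (λ t → st t ≡ nothing) v≡ v-unpaired) later-paired))
          where
            c₀ = mirror k j
            v≡ = candidate≡ j j<k
            v-unpaired = isUnpaired-true st v v-free
            later-paired : ∀ c → c₀ < c → c < k → st (addMod left c) ≢ nothing
            later-paired c c₀<c c<k = isUnpaired-false st _
              (subst (λ t → isUnpaired st t ≡ false) (candidate-mirror c c<k)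
                (before (mirror k c) (subst (mirror k c <_) (mirror-mirror j<k) (mirror-antitone c₀<c c<k))))

    round-down-leftmost : lookup P i ≡ d → ¬ InPrefix σ k (subMod s 1) →
                          StateInvariant (suc k) (pairWith st s (firstWith (isUnpaired st) (traversal σ i)))
    round-down-leftmost Pi≡d no-left-neighbour rewrite traversal-rightward i no-left-neighbour =
      first-unpaired (firstWith (isUnpaired st) (applyUpTo candidate k)) refl
      where
        geometry = block-extend-left i ccp no-left-neighbour
        next = addMod s 1
        block₁ = proj₂ geometry
        nested₁ = nested-transport k left next st (toℕ<n i) block block₁ nested
        candidate : ℕ → Fin m
        candidate j = addMod s (suc j)
        candidate≡ : ∀ j → candidate j ≡ addMod next j
        candidate≡ j = sym (addMod-addMod s 1 j)
        first-unpaired : (r : Maybe (Fin m)) → firstWith (isUnpaired st) (applyUpTo candidate k) ≡ r →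
                         StateInvariant (suc k) (pairWith st s r)
        first-unpaired nothing none with unpaired-exists Pi≡d
        ... | x , x∈ , x-unpaired with to (block₁ x) x∈
        ...   | j , j<k , x≡ = ⊥-elim (isUnpaired-false st _ (firstWith-nothing (isUnpaired st) candidate k none j j<k)
                                 (subst (λ t → st t ≡ nothing) (trans x≡ (sym (candidate≡ j))) x-unpaired))
        first-unpaired (just v) first with firstWith-just (isUnpaired st) candidate k first
        ... | c₀ , c₀<k , refl , v-free , before =
          down-step Pi≡d v (from (block₁ v) (c₀ , c₀<k , candidate≡ c₀)) v-unpaired s (proj₁ geometry)
            (subst₂ (λ a b → NestedOn (suc k) (addMod s) (pair st a b)) (addMod-identityʳ s) (sym (candidate≡ c₀))
              (nested-prepend-pair k (addMod next) st nested₁ symmetric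
                (λ x y paired → to (block₁ y) (proj₂ (paired-InPrefix x y paired)))
                (addMod s) candidate≡ (injective-from s)
                (trans (cong st (addMod-identityʳ s)) (σ-unpaired i I)) c₀ c₀<k
                (subst (λ t → st t ≡ nothing) (candidate≡ c₀) v-unpaired) earlier-paired))
          where
            v-unpaired = isUnpaired-true st v v-free
            earlier-paired : ∀ c → c < c₀ → st (addMod next c) ≢ nothing
            earlier-paired c c<c₀ = isUnpaired-false st _ (subst (λ t → isUnpaired st t ≡ false) (candidate≡ c) (before c c<c₀))

  round : ∀ i {st} → StateInvariant (toℕ i) st → StateInvariant (suc (toℕ i)) (algStep P σ st i)
  round i I with lookup P i in Pi
  ... | u = round-up i I Pi
  ... | d = round-down (inPrefix? σ (toℕ i) (subMod σ⟨ i ⟩ 1))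
    where
      round-down : Dec (InPrefix σ (toℕ i) (subMod σ⟨ i ⟩ 1)) →
                   StateInvariant (suc (toℕ i)) (pairWith _ σ⟨ i ⟩ (firstWith (isUnpaired _) (traversal σ i)))
      round-down (yes left-neighbour)   = round-down-rightmost i I Pi left-neighbour
      round-down (no no-left-neighbour) = round-down-leftmost i I Pi no-left-neighbour

  initial : StateInvariant 0 (λ _ → nothing)
  initial = record
    { paired-InPrefix = λ _ _ ()
    ; symmetric       = λ _ _ ()
    ; partner-side    = λ _ _ ()
    ; downs-paired    = λ _ ()
    ; unpaired-count  = refl
    ; left            = fzero
    ; block           = λ _ → mk⇔ (λ { (_ , () , _) }) (λ { (_ , () , _) })
    ; nested          = λ _ _ _ _ _ () }

  rounds : ∀ K (g : Fin K → Fin m) k₀ st → (∀ j → toℕ (g j) ≡ k₀ + toℕ j) → StateInvariant k₀ st →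
           StateInvariant (k₀ + K) (foldl (algStep P σ) st (Data.List.tabulate g))
  rounds zero    g k₀ st g≡ I = subst (λ k → StateInvariant k st) (sym (+-identityʳ k₀)) I
  rounds (suc K) g k₀ st g≡ I = subst (λ k → StateInvariant k (foldl (algStep P σ) st₁ (Data.List.tabulate (λ j → g (fsuc j)))))
    (sym (+-suc k₀ K)) (rounds K (λ j → g (fsuc j)) (suc k₀) st₁ (λ j → trans (g≡ (fsuc j)) (+-suc k₀ (toℕ j))) I₁)
    where
      st₁ = algStep P σ st (g fzero)
      g₀≡ : toℕ (g fzero) ≡ k₀
      g₀≡ = trans (g≡ fzero) (+-identityʳ k₀)
      I₁ : StateInvariant (suc k₀) st₁
      I₁ = subst (λ k → StateInvariant (suc k) st₁) g₀≡ (round (g fzero) (subst (λ k → StateInvariant k st) (sym g₀≡) I))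

  final : State m
  final = inverseAlgorithm P σ

  final-invariant : StateInvariant m final
  final-invariant = rounds m (λ i → i) 0 (λ _ → nothing) (λ _ → refl) initial

  module Output (P-balanced : #u (toList P) ≡ #d (toList P)) where
    open StateInvariant final-invariant

    no-unpaired : countBelow (unpairedAt final) m ≡ 0
    no-unpaired = +-cancelʳ-≡ (#d (toList P)) _ 0
      (trans (subst (λ w → countBelow (unpairedAt final) m + #d w ≡ #u w) whole unpaired-count) P-balanced)
      where
        whole : prefix m ≡ toList P
        whole = take-all m (toList P) (≤-reflexive (length-toList P))

    partner : ∀ x → ∃ λ y → final x ≡ just y
    partner x with final x in eq
    ... | just y  = y , refl
    ... | nothing = ⊥-elim (isUnpaired-false final x still-unpaired eq)
      where
        x-index = σ ⟨$⟩ˡ x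
        still-unpaired : isUnpaired final x ≡ false
        still-unpaired = trans (sym (trans (unpairedAt-toℕ final x-index) (cong (isUnpaired final) (σ-inverse x))))
                               (countBelow-zero (unpairedAt final) m no-unpaired (toℕ x-index) (toℕ<n x-index))

    τ : Fin m → Fin m
    τ x = proj₁ (partner x)

    final≡τ : ∀ x → final x ≡ just (τ x)
    final≡τ x = proj₂ (partner x)

    τ-involutive : ∀ x → τ (τ x) ≡ x
    τ-involutive x = just-injective (trans (sym (final≡τ (τ x))) (symmetric x (τ x) (final≡τ x)))

    τ-fixedPointFree : ∀ x → τ x ≢ x
    τ-fixedPointFree x τx≡x = irreflexive final-invariant x (subst (λ y → final x ≡ just y) τx≡x (final≡τ x))

    nested-from : ∀ r → NestedOn m (addMod (addMod left r)) final
    nested-from zero    = subst (λ L → NestedOn m (addMod L) final) (sym (addMod-identityʳ left)) nested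
    nested-from (suc r) = subst (λ L → NestedOn m (addMod L) final) (trans (addMod-addMod left r 1) (cong (addMod left) (+-comm r 1)))
      (nested-rotate m (addMod L) final (nested-from r) symmetric
        (λ _ y _ → addMod-surjective L y) (λ a b a<m b<m → addMod-injective L a<m b<m) (λ j _ → partner (addMod L j))
        (addMod (addMod L 1)) (λ j _ → addMod-addMod L 1 j)
        (λ j sj≡m → trans (addMod-addMod L 1 j) (trans (cong (addMod L) sj≡m) (addMod-period L 0))))
      where L = addMod left r

    τ-noncrossing : ∀ i j → toℕ i < toℕ j → toℕ j < toℕ (τ i) → toℕ i < toℕ (τ j) × toℕ (τ j) < toℕ (τ i)
    τ-noncrossing i j i<j j<τi with nested-in-order (toℕ i) (toℕ j) (toℕ (τ i)) i<j j<τi (toℕ<n (τ i))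
                                     (subst₂ (λ a b → final a ≡ just b) (sym (addMod-fzero-toℕ i)) (sym (addMod-fzero-toℕ (τ i))) (final≡τ i))
      where
        nested-in-order : NestedOn m (addMod fzero) final
        nested-in-order = subst (λ L → NestedOn m (addMod L) final) (subMod-toℕ-self left) (nested-from (m ∸ toℕ left))
    ... | b , i<b , b<τi , arc = subst (toℕ i <_) (sym τj≡b) i<b , subst (_< toℕ (τ i)) (sym τj≡b) b<τi
      where
        τj≡b : toℕ (τ j) ≡ b
        τj≡b = trans (cong toℕ (just-injective (trans (sym (final≡τ j)) (trans (cong final (sym (addMod-fzero-toℕ j))) arc))))
                     (toℕ-addMod-fzero (<-trans b<τi (toℕ<n (τ i))))

    σPath≡P : σPath σ τ ≡ P
    σPath≡P = trans (tabulate-cong step) (tabulate∘lookup P)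
      where
        step : ∀ i → (if ⌊ inPrefix? σ (suc (toℕ i)) (τ σ⟨ i ⟩) ⌋ then d else u) ≡ lookup P i
        step i with inPrefix? σ (suc (toℕ i)) (τ σ⟨ i ⟩) | lookup P i | partner-side i (τ σ⟨ i ⟩) (final≡τ σ⟨ i ⟩)
        ... | yes _      | d | _             = refl
        ... | no  _      | u | _             = refl
        ... | yes later  | u | (_ , not-yet) = ⊥-elim (not-yet refl later)
        ... | no  ¬later | d | (earlier , _) = ⊥-elim (¬later (InPrefix-mono (n≤1+n (toℕ i)) (earlier refl)))

theorem5 : (n : ℕ) → 1 ≤ n → (σ : Permutation′ (2 * n)) → IsCCP σ →
           (P : Vec Step (2 * n)) → IsDyck n P →
           ∃ λ (Q : Vec Step (2 * n)) → IsDyck n Q × ∃ λ (τ : Fin (2 * n) → Fin (2 * n)) →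
             (∀ i → inverseAlgorithm P σ i ≡ just (τ i)) × IsTunneling Q τ × (σPath σ τ ≡ P)
theorem5 (suc n) _ σ ccp P (#u≡n , #d≡n , P-prefixes) =
  path , balanced⇒IsDyck (suc n) path path-balanced path-prefixes , τ , final≡τ , path-tunneling , σPath≡P
  where
    open AlgorithmRun σ ccp P P-prefixes
    open Output (trans #u≡n (sym #d≡n))
    open NoncrossingMatching τ τ-involutive τ-fixedPointFree τ-noncrossing
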